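{- Let $\lambda/\mu$, $\nu/\rho$ be skew shapes, $D$ the shuffle diagram of shape $(\lambda/\mu)\circledast(\nu/\rho)$, and $S$ a Yamanouchi shuffle tableau of this shape. Then $\varphi^{ -1}(S)$ is $D$-compatible.
   Context: English convention: $(i,j)$ is row $i$ (top to bottom), column $j$; North = up, East = right. The shuffle diagram $D$ has a square at $(2i-1,2j-1)$ for each square $(i,j)$ of $\lambda/\mu$ and at $(2i,2j)$ for each square $(i,j)$ of $\nu/\rho$. A shuffle tableau is a filling of $D$ by positive integers weakly increasing along rows of $D$ and strictly increasing down columns of $D$. For a shuffle tableau $S$ and $i\ge1$, an $(i,i+1)$-overlap is a pair of squares in the same column, one containing $i$ and the other $i+1$. The $i$-reading word $w_i(S)$ is obtained by taking the squares containing $i$ or $i+1$, deleting all squares in $(i,i+1)$-overlaps, and reading the rest row by row from the bottom row to the top row, each row left to right. Regarding each $i+1$ as "(" and each $i$ as ")" and matching parentheses in the usual way, $E_i$ can be applied to $S$ iff $w_i(S)$ contains an unmatched $i+1$; $S$ is Yamanouchi if no $E_i$ ($i\ge1$) can be applied. Label the $N$ squares of $D$ by $1,\ldots,N$ row by row from the top row to the bottom row, within each row from right to left. $\varphi^{ -1}(S)$ is the array whose row $r$ consists of the labels of the squares of $S$ containing $r$, arranged increasingly. A standard Young tableau $T$ with entries $1,\ldots,N$ is $D$-compatible if: (1) whenever squares $i+1$ and $i$ lie in the same row of $D$, the entry $i+1$ lies in $T$ in a row weakly above and a column strictly to the right of the entry $i$; (2) whenever square $i$ is at $(r,c)$ and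 square $j$ at $(r+2,c)$ in $D$, the entry $i$ lies in $T$ in a row strictly above and a column weakly to the right of the entry $j$. -}

module Defs where

open import Data.Nat using (ℕ; zero; suc; _+_; _*_; _≤_; _<_; _⊔_; _≤ᵇ_; _<ᵇ_; _≡ᵇ_; ⌊_/2⌋; ⌈_/2⌉; _%_)
open import Data.Bool using (Bool; true; false; _∧_; _∨_; not; if_then_else_)
open import Data.List using (List; []; _∷_; map; concatMap; reverse; upTo; length; concat; zip; foldr)
open import Data.Maybe using (Maybe; just; nothing)
open import Data.Product using (_×_; _,_; proj₁; proj₂)
open import Relation.Binary.PropositionalEquality using (_≡_)
open import Data.List.Relation.Binary.Permutation.Propositional using (_↭_)

-- 1-indexed lookup with default: part xs i = i-th entry (0 if absent or i = 0)
part : List ℕ → ℕ → ℕ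
part []       _             = 0
part (x ∷ xs) zero          = 0
part (x ∷ xs) (suc zero)    = x
part (x ∷ xs) (suc (suc n)) = part xs (suc n)

nth : {A : Set} → List A → ℕ → Maybe A
nth []       _             = nothing
nth (x ∷ xs) zero          = nothing
nth (x ∷ xs) (suc zero)    = just x
nth (x ∷ xs) (suc (suc n)) = nth xs (suc n)

rowOf : List (List ℕ) → ℕ → List ℕ
rowOf []       _             = []
rowOf (x ∷ xs) zero          = []
rowOf (x ∷ xs) (suc zero)    = x
rowOf (x ∷ xs) (suc (suc n)) = rowOf xs (suc n)

filterᵇ : {A : Set} → (A → Bool) → List A → List A
filterᵇ p []       = []
filterᵇ p (x ∷ xs) = if p x then x ∷ filterᵇ p xs else filterᵇ p xs

anyᵇ : {A : Set} → (A → Bool) → List A → Bool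
anyᵇ p []       = false
anyᵇ p (x ∷ xs) = p x ∨ anyᵇ p xs

maxL : List ℕ → ℕ
maxL = foldr _⊔_ 0

range1 : ℕ → List ℕ
range1 n = map suc (upTo n)

IsPartition : List ℕ → Set
IsPartition la = ∀ i → 1 ≤ i → part la (suc i) ≤ part la i

_⊆ₚ_ : List ℕ → List ℕ → Set
mu ⊆ₚ la = ∀ i → part mu i ≤ part la i

inSkew : List ℕ → List ℕ → ℕ → ℕ → Bool
inSkew la mu i j = (1 ≤ᵇ i) ∧ ((part mu i <ᵇ j) ∧ (j ≤ᵇ part la i))

-- entry T a b : entry in row a, column b (both 1-indexed)
entry : List (List ℕ) → ℕ → ℕ → Maybe ℕ
entry T a b = nth (rowOf T a) b

At : List (List ℕ) → ℕ → ℕ → ℕ → Set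
At T e a b = entry T a b ≡ just e

IsSYT : ℕ → List (List ℕ) → Set
IsSYT N T =
    (∀ a → 1 ≤ a → length (rowOf T (suc a)) ≤ length (rowOf T a))
  × (∀ a b x y → entry T a b ≡ just x → entry T a (suc b) ≡ just y → x < y)
  × (∀ a b x y → entry T a b ≡ just x → entry T (suc a) b ≡ just y → x < y)
  × (concat T ↭ range1 N)

-- true = "(" (an i+1), false = ")" (an i).  Number of unmatched "(".
unmatchedOpen : ℕ → List Bool → ℕ
unmatchedOpen o []             = o
unmatchedOpen o (true ∷ w)     = unmatchedOpen (suc o) w
unmatchedOpen zero (false ∷ w) = unmatchedOpen zero w
unmatchedOpen (suc o) (false ∷ w) = unmatchedOpen o w

module Shuffle (la mu nu rh : List ℕ) where

  isOdd : ℕ → Bool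
  isOdd n = n % 2 ≡ᵇ 1

  inD : ℕ → ℕ → Bool
  inD r c = (isOdd r ∧ (isOdd c ∧ inSkew la mu ⌈ r /2⌉ ⌈ c /2⌉))
          ∨ (not (isOdd r) ∧ (not (isOdd c) ∧ inSkew nu rh ⌊ r /2⌋ ⌊ c /2⌋))

  rowBound : ℕ
  rowBound = 2 * (length la ⊔ length nu)

  colBound : ℕ
  colBound = 2 * (maxL la ⊔ maxL nu)

  -- squares of D in label order: top row to bottom row, each row right to left
  cellsD : List (ℕ × ℕ)
  cellsD = concatMap (λ r → map (λ c → (r , c)) (filterᵇ (λ c → inD r c) (reverse (range1 colBound))))
                     (range1 rowBound)

  N : ℕ
  N = length cellsD

  cellOf : ℕ → Maybe (ℕ × ℕ)
  cellOf k = nth cellsD k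

  labelled : List (ℕ × (ℕ × ℕ))
  labelled = zip (range1 N) cellsD

  -- Shuffle tableaux: fillings S : ℕ → ℕ → ℕ (only values on D matter)
  IsShuffleTableau : (ℕ → ℕ → ℕ) → Set
  IsShuffleTableau S =
      (∀ r c → inD r c ≡ true → 1 ≤ S r c)
    × (∀ r c c' → inD r c ≡ true → inD r c' ≡ true → c < c' → S r c ≤ S r c')
    × (∀ r r' c → inD r c ≡ true → inD r' c ≡ true → r < r' → S r c < S r' c)

  inOverlap : (ℕ → ℕ → ℕ) → ℕ → ℕ × ℕ → Bool
  inOverlap S i (r , c) =
    anyᵇ (λ x → (proj₂ x ≡ᵇ c) ∧
               (((S r c ≡ᵇ i) ∧ (S (proj₁ x) (proj₂ x) ≡ᵇ suc i))
              ∨ ((S r c ≡ᵇ suc i) ∧ (S (proj₁ x) (proj₂ x) ≡ᵇ i))))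
         cellsD

  -- i-reading word: bottom row to top row, each row left to right
  -- (= reverse of label order); true encodes i+1, false encodes i.
  readingWord : (ℕ → ℕ → ℕ) → ℕ → List Bool
  readingWord S i =
    map (λ x → S (proj₁ x) (proj₂ x) ≡ᵇ suc i)
        (filterᵇ (λ x → ((S (proj₁ x) (proj₂ x) ≡ᵇ i) ∨ (S (proj₁ x) (proj₂ x) ≡ᵇ suc i))
                        ∧ not (inOverlap S i x))
                 (reverse cellsD))

  -- E_i can be applied iff the i-reading word has an unmatched i+1
  IsYamanouchi : (ℕ → ℕ → ℕ) → Set
  IsYamanouchi S = ∀ i → 1 ≤ i → unmatchedOpen 0 (readingWord S i) ≡ 0

  -- φ⁻¹(S): row v = labels of squares containing v, increasingly; rows 1..max entry
  phiInv : (ℕ → ℕ → ℕ) → List (List ℕ)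
  phiInv S =
    map (λ v → map proj₁ (filterᵇ (λ x → S (proj₁ (proj₂ x)) (proj₂ (proj₂ x)) ≡ᵇ v) labelled))
        (range1 (maxL (map (λ x → S (proj₁ x) (proj₂ x)) cellsD)))

  IsDCompatible : List (List ℕ) → Set
  IsDCompatible T =
      IsSYT N T
    × (∀ i r c c' → cellOf i ≡ just (r , c) → cellOf (suc i) ≡ just (r , c')
         → ∀ a b a' b' → At T i a b → At T (suc i) a' b' → (a' ≤ a) × (b < b'))
    × (∀ i j r c → cellOf i ≡ just (r , c) → cellOf j ≡ just (2 + r , c)
         → ∀ a b a' b' → At T i a b → At T j a' b' → (a < a') × (b' ≤ b))

-- Label k of D carries the value val k of its square, and φ⁻¹(S) puts k in row val k and column
-- occ (val k) k, the number of labels ≤ k carrying that value.  Everything rests on the lattice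
-- inequality occ (v + 1) p ≤ occ v p for every prefix p of the labels: the labels ≤ p are read last,
-- so for squares outside (v, v + 1)-overlaps it is the Yamanouchi condition on a suffix of the reading
-- word, while each overlapped v + 1 lies below an overlapped v of its column, of smaller label.  This
-- gives the shape and the row and column conditions of a standard tableau, and condition (1).
-- For condition (2), with i at (r, c), j at (r + 2, c) and u = val i < w = val j, one needs
-- occ w j ≤ occ u i.  The labels between i and j run through row r left of c, row r + 1, and
-- row r + 2 right of c; cutting row r + 1 at a suitable value and comparing squares of rows r and
-- r + 2 that share a column (they exist because λ/μ and ν/ρ are skew shapes) settles the cases
-- w = u + 1, w = u + 2 and w ≥ u + 3.

module Submission where

open import Data.Bool using (Bool; true; false; _∧_; _∨_; not)
open import Data.Bool.Properties using (T-≡; not-¬; not-injective; ∨-zeroʳ; ∧-comm; ∧-zeroʳ; ∧-identityʳ)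
open import Data.Empty using (⊥; ⊥-elim)
open import Data.List using (List; []; _∷_; _++_; length; map; reverse; concat; zip; applyUpTo; [_])
open import Data.List.Properties using (map-++; reverse-++; unfold-reverse; map-∘; map-id; map-cong)
open import Data.List.Membership.Propositional using (_∈_)
open import Data.List.Membership.Propositional.Properties using (∈-map⁺; ∈-map⁻; ∈-concat⁺′; ∈-upTo⁺)
open import Data.List.Relation.Binary.Permutation.Propositional using (_↭_; ↭-refl; ↭-trans; ↭-prep)
open import Data.List.Relation.Binary.Permutation.Propositional.Properties using (shift; ++⁺ˡ)
open import Data.List.Relation.Unary.All as All using (All; []; _∷_)
open import Data.List.Relation.Unary.AllPairs as AllPairs using (AllPairs; []; _∷_)
open import Data.List.Relation.Unary.Any using (here; there)
import Data.List.Relation.Unary.All.Properties as All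
import Data.List.Relation.Unary.AllPairs.Properties as AllPairs
import Data.List.Relation.Unary.Any.Properties as Any
open import Data.Maybe using (just; fromMaybe)
open import Data.Nat
open import Data.Nat.Properties
open import Data.Product using (∃-syntax; _×_; _,_; proj₁; proj₂)
open import Data.Sum using (_⊎_; inj₁; inj₂)
open import Function using (id; _∘_; flip; Equivalence)
open import Relation.Binary.Definitions using (tri<; tri≈; tri>)
open import Relation.Binary.PropositionalEquality hiding ([_])
open import Relation.Nullary using (¬_; yes; no)

open import Algebra.Properties.CommutativeSemigroup +-commutativeSemigroup using (interchange)

open import Defs

≡ᵇ≡true⇒≡ : ∀ {m n} → (m ≡ᵇ n) ≡ true → m ≡ n
≡ᵇ≡true⇒≡ {m} {n} = ≡ᵇ⇒≡ m n ∘ Equivalence.from T-≡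

≡⇒≡ᵇ≡true : ∀ {m n} → m ≡ n → (m ≡ᵇ n) ≡ true
≡⇒≡ᵇ≡true {m} {n} = Equivalence.to T-≡ ∘ ≡⇒≡ᵇ m n

≢⇒≡ᵇ≡false : ∀ {m n} → m ≢ n → (m ≡ᵇ n) ≡ false
≢⇒≡ᵇ≡false {m} {n} m≢n with m ≡ᵇ n in eq
... | true  = ⊥-elim (m≢n (≡ᵇ≡true⇒≡ eq))
... | false = refl

<ᵇ≡true⇒< : ∀ {m n} → (m <ᵇ n) ≡ true → m < n
<ᵇ≡true⇒< {m} {n} = <ᵇ⇒< m n ∘ Equivalence.from T-≡

<⇒<ᵇ≡true : ∀ {m n} → m < n → (m <ᵇ n) ≡ true
<⇒<ᵇ≡true = Equivalence.to T-≡ ∘ <⇒<ᵇ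

≤ᵇ≡true⇒≤ : ∀ {m n} → (m ≤ᵇ n) ≡ true → m ≤ n
≤ᵇ≡true⇒≤ {m} {n} = ≤ᵇ⇒≤ m n ∘ Equivalence.from T-≡

≤⇒≤ᵇ≡true : ∀ {m n} → m ≤ n → (m ≤ᵇ n) ≡ true
≤⇒≤ᵇ≡true = Equivalence.to T-≡ ∘ ≤⇒≤ᵇ

∧≡true⇒ : ∀ {a b} → (a ∧ b) ≡ true → a ≡ true × b ≡ true
∧≡true⇒ {true} b≡true = refl , b≡true

false≢true : false ≢ true
false≢true ()

∧-≡true : ∀ {a b} → a ≡ true → b ≡ true → (a ∧ b) ≡ true
∧-≡true refl refl = refl

∨≡true⇒ : ∀ {a b} → (a ∨ b) ≡ true → a ≡ true ⊎ b ≡ true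
∨≡true⇒ {true}  _       = inj₁ refl
∨≡true⇒ {false} b≡true = inj₂ b≡true

fromBool : Bool → ℕ
fromBool true  = 1
fromBool false = 0

-- Counting over intervals of ℕ

interval : ℕ → ℕ → List ℕ
interval o zero    = []
interval o (suc n) = suc o ∷ interval (suc o) n

InInterval : ℕ → ℕ → ℕ → Set
InInterval o n k = o < k × k ≤ o + n

count : (ℕ → Bool) → ℕ → ℕ → ℕ
count P o zero    = 0
count P o (suc n) = fromBool (P (suc o)) + count P (suc o) n

private
  first∈ : ∀ o n → InInterval o (suc n) (suc o)
  first∈ o n = ≤-refl , subst (suc o ≤_) (sym (+-suc o n)) (s≤s (m≤m+n o n))

  rest⊆ : ∀ {o n k} → InInterval (suc o) n k → InInterval o (suc n) k
  rest⊆ {o} {n} {k} (o<k , k≤o+n) = <⇒≤ o<k , subst (k ≤_) (sym (+-suc o n)) k≤o+n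

InInterval-empty : ∀ {o k} → ¬ InInterval o 0 k
InInterval-empty {o} (o<k , k≤o) = <⇒≱ o<k (subst (_ ≤_) (+-identityʳ o) k≤o)

count-cong : ∀ {P Q} o n → (∀ k → InInterval o n k → P k ≡ Q k) → count P o n ≡ count Q o n
count-cong o zero    P≡Q = refl
count-cong o (suc n) P≡Q =
  cong₂ _+_ (cong fromBool (P≡Q (suc o) (first∈ o n))) (count-cong (suc o) n (λ k → P≡Q k ∘ rest⊆))

count-none : ∀ {P} o n → (∀ k → InInterval o n k → P k ≡ true → ⊥) → count P o n ≡ 0
count-none         o zero    none = refl
count-none {P} o (suc n) none with P (suc o) in eq
... | true  = ⊥-elim (none (suc o) (first∈ o n) eq)
... | false = count-none (suc o) n (λ k → none k ∘ rest⊆)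

count-+ : ∀ P o m n → count P o (m + n) ≡ count P o m + count P (o + m) n
count-+ P o zero    n rewrite +-identityʳ o = refl
count-+ P o (suc m) n rewrite count-+ P (suc o) m n | +-suc o m =
  sym (+-assoc (fromBool (P (suc o))) (count P (suc o) m) (count P (suc (o + m)) n))

count-+-none : ∀ P o m n → (∀ k → InInterval (o + m) n k → P k ≡ true → ⊥) → count P o (m + n) ≡ count P o m
count-+-none P o m n none = begin
  count P o (m + n)                  ≡⟨ count-+ P o m n ⟩
  count P o m + count P (o + m) n    ≡⟨ cong (count P o m +_) (count-none (o + m) n none) ⟩
  count P o m + 0                    ≡⟨ +-identityʳ _ ⟩
  count P o m                        ∎
  where open ≡-Reasoning

count-snoc : ∀ P o n → count P o (suc n) ≡ count P o n + fromBool (P (suc (o + n)))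
count-snoc P o n = begin
  count P o (suc n)                                ≡⟨ cong (count P o) (+-comm 1 n) ⟩
  count P o (n + 1)                                ≡⟨ count-+ P o n 1 ⟩
  count P o n + (fromBool (P (suc (o + n))) + 0)   ≡⟨ cong (count P o n +_) (+-identityʳ _) ⟩
  count P o n + fromBool (P (suc (o + n)))         ∎
  where open ≡-Reasoning

count-monoʳ : ∀ P o {m n} → m ≤ n → count P o m ≤ count P o n
count-monoʳ P o {m} m≤n with m≤n⇒∃[o]m+o≡n m≤n
... | d , refl = subst (count P o m ≤_) (sym (count-+ P o m d)) (m≤m+n _ _)

count-∧-split : ∀ (P Q : ℕ → Bool) o n →
  count P o n ≡ count (λ k → P k ∧ Q k) o n + count (λ k → P k ∧ not (Q k)) o n
count-∧-split P Q o zero    = refl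
count-∧-split P Q o (suc n) =
  trans (cong₂ _+_ (split-head (P (suc o)) (Q (suc o))) (count-∧-split P Q (suc o) n))
        (interchange (fromBool (P (suc o) ∧ Q (suc o))) (fromBool (P (suc o) ∧ not (Q (suc o)))) _ _)
  where
  split-head : ∀ a b → fromBool a ≡ fromBool (a ∧ b) + fromBool (a ∧ not b)
  split-head false b     = refl
  split-head true  false = refl
  split-head true  true  = refl

count-remove : ∀ B t o n → InInterval o n t → B t ≡ true →
  count B o n ≡ suc (count (λ k → B k ∧ not (k ≡ᵇ t)) o n)
count-remove B t o zero    t∈ _    = ⊥-elim (InInterval-empty t∈)
count-remove B t o (suc n) t∈ Bt with suc o ≟ t
... | yes refl rewrite Bt | ≡⇒≡ᵇ≡true {suc o} refl =
  cong suc (count-cong (suc o) n (λ k k∈ → sym (keep k (proj₁ k∈))))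
  where
  keep : ∀ k → suc o < k → (B k ∧ not (k ≡ᵇ suc o)) ≡ B k
  keep k o<k rewrite ≢⇒≡ᵇ≡false (>⇒≢ o<k) with B k
  ... | true  = refl
  ... | false = refl
... | no o≢t rewrite ≢⇒≡ᵇ≡false o≢t
                   | count-remove B t (suc o) n (≤∧≢⇒< (proj₁ t∈) o≢t , subst (t ≤_) (+-suc o n) (proj₂ t∈)) Bt
                   with B (suc o)
...   | true  = refl
...   | false = refl

count-injection : ∀ {A B : ℕ → Bool} (R : ℕ → ℕ → Set) a n b m →
  (∀ k → InInterval a n k → A k ≡ true → ∃[ k' ] R k k' × InInterval b m k' × B k' ≡ true) →
  (∀ {k₁ k₂ k'} → R k₁ k' → R k₂ k' → k₁ ≡ k₂) →
  count A a n ≤ count B b m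
count-injection R a zero    b m f f-inj = z≤n
count-injection {A} {B} R a (suc n) b m f f-inj with A (suc a) in eqA
... | false = count-injection R (suc a) n b m (λ k → f k ∘ rest⊆) f-inj
... | true with f (suc a) (first∈ a n) eqA
...   | t , Rat , t∈ , Bt =
  subst (suc (count A (suc a) n) ≤_) (sym (count-remove B t b m t∈ Bt))
        (s≤s (count-injection R (suc a) n b m f′ f-inj))
  where
  f′ : ∀ k → InInterval (suc a) n k → A k ≡ true →
       ∃[ k' ] R k k' × InInterval b m k' × (B k' ∧ not (k' ≡ᵇ t)) ≡ true
  f′ k k∈ Ak with f k (rest⊆ k∈) Ak
  ... | k' , Rkk' , k'∈ , Bk' = k' , Rkk' , k'∈ , avoid
    where
    avoid : (B k' ∧ not (k' ≡ᵇ t)) ≡ true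
    avoid rewrite Bk' | ≢⇒≡ᵇ≡false {k'} {t} (λ { refl → >⇒≢ (proj₁ k∈) (f-inj Rkk' Rat) }) = refl

upward-closed-split : ∀ (B : ℕ → Bool) o n →
  (∀ k k' → o < k → k ≤ k' → k' ≤ o + n → B k ≡ true → B k' ≡ true) →
  ∃[ t ] ∃[ m ] t + m ≡ n
              × (∀ k → InInterval o t k → B k ≡ false)
              × (∀ k → InInterval (o + t) m k → B k ≡ true)
upward-closed-split B o zero    up =
  0 , 0 , refl , (λ k → ⊥-elim ∘ InInterval-empty) , (λ k → ⊥-elim ∘ InInterval-empty)
upward-closed-split B o (suc n) up with B (suc o) in eqB
... | true  = 0 , suc n , refl , (λ k → ⊥-elim ∘ InInterval-empty)
                , (λ k k∈ → up (suc o) k ≤-refl (subst (_< k) (+-identityʳ o) (proj₁ k∈))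
                                  (subst (k ≤_) (cong (_+ suc n) (+-identityʳ o)) (proj₂ k∈)) eqB)
... | false with upward-closed-split B (suc o) n
                   (λ k k' o<k k≤k' k'≤ → up k k' (<⇒≤ o<k) k≤k' (subst (k' ≤_) (sym (+-suc o n)) k'≤))
...   | t , m , t+m≡n , below , above =
  suc t , m , cong suc t+m≡n , below′ , (λ k k∈ → above k (subst (λ z → InInterval z m k) (+-suc o t) k∈))
  where
  below′ : ∀ k → InInterval o (suc t) k → B k ≡ false
  below′ k (o<k , k≤) with suc o ≟ k
  ... | yes refl = eqB
  ... | no o≢k  = below k (≤∧≢⇒< o<k o≢k , subst (k ≤_) (+-suc o t) k≤)

length-filterᵇ-interval : ∀ P o n → length (filterᵇ P (interval o n)) ≡ count P o n
length-filterᵇ-interval P o zero    = refl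
length-filterᵇ-interval P o (suc n) with P (suc o)
... | true  = cong suc (length-filterᵇ-interval P (suc o) n)
... | false = length-filterᵇ-interval P (suc o) n

nth-filterᵇ-interval : ∀ P o n b e → nth (filterᵇ P (interval o n)) b ≡ just e →
  ∃[ d ] e ≡ suc (o + d) × d < n × P e ≡ true × count P o (suc d) ≡ b
nth-filterᵇ-interval P o (suc n) b e h with P (suc o) in eqP
nth-filterᵇ-interval P o (suc n) (suc zero) e refl | true =
  0 , cong suc (sym (+-identityʳ o)) , s≤s z≤n , eqP , refl
nth-filterᵇ-interval P o (suc n) (suc (suc b)) e h | true with nth-filterᵇ-interval P (suc o) n (suc b) e h
... | d , refl , d<n , Pe , c = suc d , cong suc (sym (+-suc o d)) , s≤s d<n , Pe , cong suc c
nth-filterᵇ-interval P o (suc n) b e h | false with nth-filterᵇ-interval P (suc o) n b e h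
... | d , refl , d<n , Pe , c = suc d , cong suc (sym (+-suc o d)) , s≤s d<n , Pe , c

interval-++ : ∀ o m n → interval o (m + n) ≡ interval o m ++ interval (o + m) n
interval-++ o zero    n = cong (λ z → interval z n) (sym (+-identityʳ o))
interval-++ o (suc m) n = cong (suc o ∷_) (trans (interval-++ (suc o) m n)
                                                  (cong (λ z → interval (suc o) m ++ interval z n) (sym (+-suc o m))))

range1≡interval : ∀ n → range1 n ≡ interval 0 n
range1≡interval n = shifted id 0 n (λ _ → refl)
  where
  shifted : ∀ f o n → (∀ k → f k ≡ o + k) → map suc (applyUpTo f n) ≡ interval o n
  shifted f o zero    f≡ = refl
  shifted f o (suc n) f≡ =
    cong₂ _∷_ (cong suc (trans (f≡ 0) (+-identityʳ o)))
              (shifted (f ∘ suc) (suc o) n (λ k → trans (f≡ (suc k)) (+-suc o k)))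

∈-interval⁻ : ∀ {o n k} → k ∈ interval o n → InInterval o n k
∈-interval⁻ {o} {suc n} (here refl) = first∈ o n
∈-interval⁻ {o} {suc n} (there k∈) = rest⊆ (∈-interval⁻ k∈)

∈-interval⁺ : ∀ {o n k} → InInterval o n k → k ∈ interval o n
∈-interval⁺ {o} {zero}  k∈ = ⊥-elim (InInterval-empty k∈)
∈-interval⁺ {o} {suc n} {k} (o<k , k≤) with suc o ≟ k
... | yes refl = here refl
... | no o≢k  = there (∈-interval⁺ (≤∧≢⇒< o<k o≢k , subst (k ≤_) (+-suc o n) k≤))

AllPairs-interval : ∀ {R : ℕ → ℕ → Set} {o n} → AllPairs R (interval o n) →
  ∀ {k k'} → InInterval o n k → InInterval o n k' → k < k' → R k k'
AllPairs-interval {n = zero} _ k∈ _ _ = ⊥-elim (InInterval-empty k∈)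
AllPairs-interval {o = o} {suc n} (Rhd ∷ Rtl) {k} {k'} k∈ k'∈ k<k' with suc o ≟ k
... | yes refl = All.lookup Rhd (∈-interval⁺ (k<k' , subst (k' ≤_) (+-suc o n) (proj₂ k'∈)))
... | no o≢k  = AllPairs-interval Rtl (≤∧≢⇒< (proj₁ k∈) o≢k , subst (k ≤_) (+-suc o n) (proj₂ k∈))
                  (<-trans (≤∧≢⇒< (proj₁ k∈) o≢k) k<k' , subst (k' ≤_) (+-suc o n) (proj₂ k'∈)) k<k'

nthD : {A : Set} → A → List A → ℕ → A
nthD d xs k = fromMaybe d (nth xs k)

nth≡just⇒bounds : ∀ {A : Set} (xs : List A) k {x} → nth xs k ≡ just x → InInterval 0 (length xs) k
nth≡just⇒bounds (y ∷ xs) (suc zero)    h = s≤s z≤n , s≤s z≤n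
nth≡just⇒bounds (y ∷ xs) (suc (suc k)) h = s≤s z≤n , s≤s (proj₂ (nth≡just⇒bounds xs (suc k) h))

map-nthD-interval : ∀ {A : Set} (d : A) xs → xs ≡ map (nthD d xs) (interval 0 (length xs))
map-nthD-interval d []       = refl
map-nthD-interval d (x ∷ xs) = cong (x ∷_) (trans (map-nthD-interval d xs) (sym (drop-head 0 (length xs))))
  where
  drop-head : ∀ o n → map (nthD d (x ∷ xs)) (interval (suc o) n) ≡ map (nthD d xs) (interval o n)
  drop-head o zero    = refl
  drop-head o (suc n) = cong (nthD d xs (suc o) ∷_) (drop-head (suc o) n)

AllPairs-reverse⁺ : ∀ {A : Set} {R : A → A → Set} {xs} → AllPairs R xs → AllPairs (flip R) (reverse xs)
AllPairs-reverse⁺ [] = []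
AllPairs-reverse⁺ {xs = x ∷ xs} (Rx ∷ Rxs) rewrite unfold-reverse x xs =
  AllPairs.++⁺ (AllPairs-reverse⁺ Rxs) ([] ∷ []) (All.map (_∷ []) (All.tabulate (All.lookup Rx ∘ Any.reverse⁻)))

zip-map : ∀ {A B : Set} (f : A → B) xs → zip xs (map f xs) ≡ map (λ x → x , f x) xs
zip-map f []       = refl
zip-map f (x ∷ xs) = cong ((x , f x) ∷_) (zip-map f xs)

∈⇒≤maxL : ∀ {x xs} → x ∈ xs → x ≤ maxL xs
∈⇒≤maxL {xs = y ∷ xs} (here refl) = m≤m⊔n y (maxL xs)
∈⇒≤maxL {xs = y ∷ xs} (there x∈)  = ≤-trans (∈⇒≤maxL x∈) (m≤n⊔m y (maxL xs))

module _ {A : Set} (P : A → Bool) where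

  all-filterᵇ : ∀ xs → All (λ x → P x ≡ true) (filterᵇ P xs)
  all-filterᵇ []       = []
  all-filterᵇ (x ∷ xs) with P x in eq
  ... | true  = eq ∷ all-filterᵇ xs
  ... | false = all-filterᵇ xs

  All-filterᵇ⁺ : ∀ {Q : A → Set} {xs} → All Q xs → All Q (filterᵇ P xs)
  All-filterᵇ⁺ []                       = []
  All-filterᵇ⁺ {xs = x ∷ xs} (Qx ∷ Qxs) with P x
  ... | true  = Qx ∷ All-filterᵇ⁺ Qxs
  ... | false = All-filterᵇ⁺ Qxs

  AllPairs-filterᵇ⁺ : ∀ {R : A → A → Set} {xs} → AllPairs R xs → AllPairs R (filterᵇ P xs)
  AllPairs-filterᵇ⁺ []                       = []
  AllPairs-filterᵇ⁺ {xs = x ∷ xs} (Rx ∷ Rxs) with P x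
  ... | true  = All-filterᵇ⁺ Rx ∷ AllPairs-filterᵇ⁺ Rxs
  ... | false = AllPairs-filterᵇ⁺ Rxs

  ∈-filterᵇ⁺ : ∀ {x xs} → x ∈ xs → P x ≡ true → x ∈ filterᵇ P xs
  ∈-filterᵇ⁺ {xs = y ∷ xs} (here refl) Px rewrite Px = here refl
  ∈-filterᵇ⁺ {xs = y ∷ xs} (there x∈) Px with P y
  ... | true  = there (∈-filterᵇ⁺ x∈ Px)
  ... | false = ∈-filterᵇ⁺ x∈ Px

  filterᵇ-++ : ∀ xs ys → filterᵇ P (xs ++ ys) ≡ filterᵇ P xs ++ filterᵇ P ys
  filterᵇ-++ []       ys = refl
  filterᵇ-++ (x ∷ xs) ys with P x
  ... | true  = cong (x ∷_) (filterᵇ-++ xs ys)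
  ... | false = filterᵇ-++ xs ys

filterᵇ-map : ∀ {A B : Set} (Q : B → Bool) (h : A → B) xs →
  filterᵇ Q (map h xs) ≡ map h (filterᵇ (Q ∘ h) xs)
filterᵇ-map Q h []       = refl
filterᵇ-map Q h (x ∷ xs) with Q (h x)
... | true  = cong (h x ∷_) (filterᵇ-map Q h xs)
... | false = filterᵇ-map Q h xs

anyᵇ≡true⇒ : ∀ {A : Set} (p : A → Bool) xs → anyᵇ p xs ≡ true → ∃[ x ] x ∈ xs × p x ≡ true
anyᵇ≡true⇒ p (x ∷ xs) h with p x in eq
... | true  = x , here refl , eq
... | false with anyᵇ≡true⇒ p xs h
...   | y , y∈ , py = y , there y∈ , py

∈⇒anyᵇ≡true : ∀ {A : Set} (p : A → Bool) {x xs} → x ∈ xs → p x ≡ true → anyᵇ p xs ≡ true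
∈⇒anyᵇ≡true p (here refl) px rewrite px = refl
∈⇒anyᵇ≡true p {xs = y ∷ xs} (there x∈) px with p y
... | true  = refl
... | false = ∈⇒anyᵇ≡true p x∈ px

countL : ∀ {A : Set} → (A → Bool) → List A → ℕ
countL Q []       = 0
countL Q (x ∷ xs) = fromBool (Q x) + countL Q xs

countL-++ : ∀ {A : Set} (Q : A → Bool) xs ys → countL Q (xs ++ ys) ≡ countL Q xs + countL Q ys
countL-++ Q []       ys = refl
countL-++ Q (x ∷ xs) ys = trans (cong (fromBool (Q x) +_) (countL-++ Q xs ys)) (sym (+-assoc (fromBool (Q x)) _ _))

countL-reverse : ∀ {A : Set} (Q : A → Bool) xs → countL Q (reverse xs) ≡ countL Q xs
countL-reverse Q []       = refl
countL-reverse Q (x ∷ xs) rewrite unfold-reverse x xs | countL-++ Q (reverse xs) [ x ] | countL-reverse Q xs =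
  trans (+-comm (countL Q xs) (fromBool (Q x) + 0)) (cong (_+ countL Q xs) (+-identityʳ (fromBool (Q x))))

countL-map : ∀ {A B : Set} (Q : B → Bool) (g : A → B) xs → countL Q (map g xs) ≡ countL (Q ∘ g) xs
countL-map Q g []       = refl
countL-map Q g (x ∷ xs) = cong (fromBool (Q (g x)) +_) (countL-map Q g xs)

countL-filterᵇ : ∀ {A : Set} (Q P : A → Bool) xs → countL Q (filterᵇ P xs) ≡ countL (λ x → P x ∧ Q x) xs
countL-filterᵇ Q P []       = refl
countL-filterᵇ Q P (x ∷ xs) with P x
... | true  = cong (fromBool (Q x) +_) (countL-filterᵇ Q P xs)
... | false = countL-filterᵇ Q P xs

countL-interval : ∀ (Q : ℕ → Bool) o n → countL Q (interval o n) ≡ count Q o n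
countL-interval Q o zero    = refl
countL-interval Q o (suc n) = cong (fromBool (Q (suc o)) +_) (countL-interval Q (suc o) n)

countL-map-filterᵇ-reverse : ∀ {A B : Set} (Q : B → Bool) (g : A → B) keep xs →
  countL Q (map g (filterᵇ keep (reverse xs))) ≡ countL (λ x → keep x ∧ Q (g x)) xs
countL-map-filterᵇ-reverse Q g keep xs = begin
  countL Q (map g (filterᵇ keep (reverse xs)))     ≡⟨ countL-map Q g (filterᵇ keep (reverse xs)) ⟩
  countL (Q ∘ g) (filterᵇ keep (reverse xs))       ≡⟨ countL-filterᵇ (Q ∘ g) keep (reverse xs) ⟩
  countL (λ x → keep x ∧ Q (g x)) (reverse xs)     ≡⟨ countL-reverse _ xs ⟩
  countL (λ x → keep x ∧ Q (g x)) xs               ∎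
  where open ≡-Reasoning

nth-rowOf-map-interval : ∀ (F : ℕ → List ℕ) o M a b {e} → nth (rowOf (map F (interval o M)) a) b ≡ just e →
  InInterval 0 M a × nth (F (o + a)) b ≡ just e
nth-rowOf-map-interval F o (suc M) (suc zero)    b {e} h =
  (s≤s z≤n , s≤s z≤n) ,
  subst (λ z → nth (F z) b ≡ just e) (sym (trans (+-suc o 0) (cong suc (+-identityʳ o)))) h
nth-rowOf-map-interval F o (suc M) (suc (suc a)) b {e} h with nth-rowOf-map-interval F (suc o) M (suc a) b h
... | (_ , a≤M) , h′ = (s≤s z≤n , s≤s a≤M) , subst (λ z → nth (F z) b ≡ just e) (sym (+-suc o (suc a))) h′

rowOf-map-interval : ∀ (F : ℕ → List ℕ) o M a → InInterval 0 M a → rowOf (map F (interval o M)) a ≡ F (o + a)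
rowOf-map-interval F o (suc M) (suc zero)    _           = cong F (sym (trans (+-suc o 0) (cong suc (+-identityʳ o))))
rowOf-map-interval F o (suc M) (suc (suc a)) (_ , s≤s a≤M) =
  trans (rowOf-map-interval F (suc o) M (suc a) (s≤s z≤n , a≤M)) (cong F (sym (+-suc o (suc a))))

rowOf-map-interval-beyond : ∀ (F : ℕ → List ℕ) o M a → M < a → rowOf (map F (interval o M)) a ≡ []
rowOf-map-interval-beyond F o zero    a             _          = refl
rowOf-map-interval-beyond F o (suc M) (suc (suc a)) (s≤s M<a) = rowOf-map-interval-beyond F (suc o) M (suc a) M<a

module Buckets (f : ℕ → ℕ) where

  buckets : List ℕ → ℕ → ℕ → List ℕ
  buckets L o M = concat (map (λ a → filterᵇ (λ k → f k ≡ᵇ a) L) (interval o M))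

  private
    buckets-[] : ∀ o M → buckets [] o M ≡ []
    buckets-[] o zero    = refl
    buckets-[] o (suc M) = buckets-[] (suc o) M

    buckets-skip : ∀ x L o M → f x ≤ o → buckets (x ∷ L) o M ≡ buckets L o M
    buckets-skip x L o zero    _   = refl
    buckets-skip x L o (suc M) fx≤o rewrite ≢⇒≡ᵇ≡false {f x} {suc o} (λ e → 1+n≰n (subst (_≤ o) e fx≤o)) =
      cong (filterᵇ (λ k → f k ≡ᵇ suc o) L ++_) (buckets-skip x L (suc o) M (m≤n⇒m≤1+n fx≤o))

    buckets-∷ : ∀ x L o M → InInterval o M (f x) → buckets (x ∷ L) o M ↭ x ∷ buckets L o M
    buckets-∷ x L o zero    fx∈ = ⊥-elim (InInterval-empty fx∈)
    buckets-∷ x L o (suc M) fx∈ with f x ≟ suc o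
    ... | yes fx≡ rewrite ≡⇒≡ᵇ≡true fx≡ | buckets-skip x L (suc o) M (≤-reflexive fx≡) = ↭-refl
    ... | no fx≢ rewrite ≢⇒≡ᵇ≡false fx≢ =
      ↭-trans (++⁺ˡ (filterᵇ (λ k → f k ≡ᵇ suc o) L)
                    (buckets-∷ x L (suc o) M
                      (≤∧≢⇒< (proj₁ fx∈) (fx≢ ∘ sym) , subst (f x ≤_) (+-suc o M) (proj₂ fx∈))))
              (shift x (filterᵇ (λ k → f k ≡ᵇ suc o) L) (buckets L (suc o) M))

  buckets-↭ : ∀ L o M → All (λ x → InInterval o M (f x)) L → buckets L o M ↭ L
  buckets-↭ []      o M []          = subst (_↭ []) (sym (buckets-[] o M)) ↭-refl
  buckets-↭ (x ∷ L) o M (fx∈ ∷ L∈) = ↭-trans (buckets-∷ x L o M fx∈) (↭-prep x (buckets-↭ L o M L∈))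

-- Bracket words

unmatchedOpen-++ : ∀ o xs ys → unmatchedOpen o (xs ++ ys) ≡ unmatchedOpen (unmatchedOpen o xs) ys
unmatchedOpen-++ o       []            ys = refl
unmatchedOpen-++ o       (true ∷ xs)   ys = unmatchedOpen-++ (suc o) xs ys
unmatchedOpen-++ zero    (false ∷ xs)  ys = unmatchedOpen-++ zero xs ys
unmatchedOpen-++ (suc o) (false ∷ xs)  ys = unmatchedOpen-++ o xs ys

opens≤unmatched+closes : ∀ o xs → o + countL id xs ≤ unmatchedOpen o xs + countL not xs
opens≤unmatched+closes o       []           = ≤-refl
opens≤unmatched+closes o       (true ∷ xs)  =
  subst (_≤ unmatchedOpen (suc o) xs + countL not xs) (sym (+-suc o (countL id xs))) (opens≤unmatched+closes (suc o) xs)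
opens≤unmatched+closes zero    (false ∷ xs) =
  ≤-trans (opens≤unmatched+closes zero xs) (+-monoʳ-≤ (unmatchedOpen zero xs) (n≤1+n _))
opens≤unmatched+closes (suc o) (false ∷ xs) =
  subst (suc o + countL id xs ≤_) (sym (+-suc (unmatchedOpen o xs) (countL not xs)))
        (s≤s (opens≤unmatched+closes o xs))

balanced⇒suffix-opens≤closes : ∀ xs ys → unmatchedOpen 0 (xs ++ ys) ≡ 0 → countL id ys ≤ countL not ys
balanced⇒suffix-opens≤closes xs ys balanced =
  subst (λ z → countL id ys ≤ z + countL not ys) (trans (sym (unmatchedOpen-++ 0 xs ys)) balanced)
        (≤-trans (m≤n+m (countL id ys) (unmatchedOpen 0 xs)) (opens≤unmatched+closes (unmatchedOpen 0 xs) ys))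

-- Parity and skew shapes

odd? : ℕ → Bool
odd? n = n % 2 ≡ᵇ 1

odd?-suc : ∀ n → odd? (suc n) ≡ not (odd? n)
odd?-suc zero          = refl
odd?-suc (suc zero)    = refl
odd?-suc (suc (suc n)) = odd?-suc n

same-parity⇒2+≤ : ∀ {m n} → m < n → odd? m ≡ odd? n → 2 + m ≤ n
same-parity⇒2+≤ {m} {suc n} (s≤s m≤n) same with m ≟ n
... | yes refl = ⊥-elim (not-¬ refl (trans same (odd?-suc m)))
... | no m≢n  = s≤s (≤∧≢⇒< m≤n m≢n)

n≤2*⌈n/2⌉ : ∀ n → n ≤ 2 * ⌈ n /2⌉
n≤2*⌈n/2⌉ zero          = z≤n
n≤2*⌈n/2⌉ (suc zero)    = s≤s z≤n
n≤2*⌈n/2⌉ (suc (suc n)) =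
  subst (suc (suc n) ≤_) (sym (cong suc (+-suc ⌈ n /2⌉ (⌈ n /2⌉ + 0)))) (s≤s (s≤s (n≤2*⌈n/2⌉ n)))

even⇒n≤2*⌊n/2⌋ : ∀ n → odd? n ≡ false → n ≤ 2 * ⌊ n /2⌋
even⇒n≤2*⌊n/2⌋ zero          _    = z≤n
even⇒n≤2*⌊n/2⌋ (suc (suc n)) even =
  subst (suc (suc n) ≤_) (sym (cong suc (+-suc ⌊ n /2⌋ (⌊ n /2⌋ + 0)))) (s≤s (s≤s (even⇒n≤2*⌊n/2⌋ n even)))

odd⇒1≤ : ∀ n → odd? n ≡ true → 1 ≤ n
odd⇒1≤ (suc n) _ = s≤s z≤n

1≤part⇒≤length : ∀ xs a → 1 ≤ part xs a → a ≤ length xs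
1≤part⇒≤length (x ∷ xs) zero          _ = z≤n
1≤part⇒≤length (x ∷ xs) (suc zero)    _ = s≤s z≤n
1≤part⇒≤length (x ∷ xs) (suc (suc a)) p = s≤s (1≤part⇒≤length xs (suc a) p)

part≤maxL : ∀ xs a → part xs a ≤ maxL xs
part≤maxL []       a             = z≤n
part≤maxL (x ∷ xs) zero          = z≤n
part≤maxL (x ∷ xs) (suc zero)    = m≤m⊔n x (maxL xs)
part≤maxL (x ∷ xs) (suc (suc a)) = ≤-trans (part≤maxL xs (suc a)) (m≤n⊔m x (maxL xs))

InSkew : List ℕ → List ℕ → ℕ → ℕ → Set
InSkew la mu i j = 1 ≤ i × part mu i < j × j ≤ part la i

inSkew≡true⇒ : ∀ la mu i j → inSkew la mu i j ≡ true → InSkew la mu i j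
inSkew≡true⇒ la mu i j h with ∧≡true⇒ {1 ≤ᵇ i} h
... | 1≤i , rest with ∧≡true⇒ {part mu i <ᵇ j} rest
...   | μ<j , j≤λ = ≤ᵇ≡true⇒≤ 1≤i , <ᵇ≡true⇒< μ<j , ≤ᵇ≡true⇒≤ j≤λ

InSkew⇒inSkew≡true : ∀ la mu i j → InSkew la mu i j → inSkew la mu i j ≡ true
InSkew⇒inSkew≡true la mu i j (1≤i , μ<j , j≤λ)
  rewrite ≤⇒≤ᵇ≡true 1≤i | <⇒<ᵇ≡true μ<j | ≤⇒≤ᵇ≡true j≤λ = refl

InSkew⇒bounded : ∀ la mu {i j} → InSkew la mu i j → i ≤ length la × j ≤ maxL la
InSkew⇒bounded la mu {i} (_ , μ<j , j≤λ) =
  1≤part⇒≤length la i (≤-trans (s≤s z≤n) (<-≤-trans μ<j j≤λ)) , ≤-trans j≤λ (part≤maxL la i)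

_≺_ : ℕ × ℕ → ℕ × ℕ → Set
(r , c) ≺ (r' , c') = r < r' ⊎ (r ≡ r' × c' < c)

≺-irrefl : ∀ {x} → ¬ x ≺ x
≺-irrefl (inj₁ r<r)       = <-irrefl refl r<r
≺-irrefl (inj₂ (_ , c<c)) = <-irrefl refl c<c

≺-asym : ∀ {x y} → x ≺ y → ¬ y ≺ x
≺-asym (inj₁ r<r')      (inj₁ r'<r)      = <-asym r<r' r'<r
≺-asym (inj₁ r<r')      (inj₂ (r'≡r , _)) = <-irrefl (sym r'≡r) r<r'
≺-asym (inj₂ (r≡r' , _)) (inj₁ r'<r)      = <-irrefl (sym r≡r') r'<r
≺-asym (inj₂ (_ , c'<c)) (inj₂ (_ , c<c')) = <-asym c'<c c<c'

range1-sorted : ∀ n → AllPairs _<_ (range1 n)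
range1-sorted n = AllPairs.map⁺ (AllPairs.applyUpTo⁺₁ id n (λ i<j _ → s≤s i<j))

∈-range1⁺ : ∀ {n k} → 1 ≤ k → k ≤ n → k ∈ range1 n
∈-range1⁺ {k = suc k} _ k<n = ∈-map⁺ suc (∈-upTo⁺ k<n)

module Diagram (la mu nu rh : List ℕ) where
  open Shuffle la mu nu rh

  InD : ℕ → ℕ → Set
  InD r c = (isOdd r ≡ true  × isOdd c ≡ true  × InSkew la mu ⌈ r /2⌉ ⌈ c /2⌉)
          ⊎ (isOdd r ≡ false × isOdd c ≡ false × InSkew nu rh ⌊ r /2⌋ ⌊ c /2⌋)

  inD≡true⇒ : ∀ r c → inD r c ≡ true → InD r c
  inD≡true⇒ r c h
    with isOdd r | isOdd c | inSkew la mu ⌈ r /2⌉ ⌈ c /2⌉ in e₁ | inSkew nu rh ⌊ r /2⌋ ⌊ c /2⌋ in e₂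
  ... | true  | true  | true | _    = inj₁ (refl , refl , inSkew≡true⇒ la mu _ _ e₁)
  ... | false | false | _    | true = inj₂ (refl , refl , inSkew≡true⇒ nu rh _ _ e₂)

  InD⇒inD≡true : ∀ r c → InD r c → inD r c ≡ true
  InD⇒inD≡true r c (inj₁ (odd-r , odd-c , s)) rewrite odd-r | odd-c | InSkew⇒inSkew≡true la mu _ _ s = refl
  InD⇒inD≡true r c (inj₂ (even-r , even-c , s)) rewrite even-r | even-c = InSkew⇒inSkew≡true nu rh _ _ s

  inD-parity : ∀ r c → inD r c ≡ true → isOdd r ≡ isOdd c
  inD-parity r c h with inD≡true⇒ r c h
  ... | inj₁ (odd-r , odd-c , _)   = trans odd-r (sym odd-c)
  ... | inj₂ (even-r , even-c , _) = trans even-r (sym even-c)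

  inD-bounds : ∀ r c → inD r c ≡ true → (1 ≤ r × r ≤ rowBound) × (1 ≤ c × c ≤ colBound)
  inD-bounds r c h with inD≡true⇒ r c h
  ... | inj₁ (odd-r , odd-c , s) =
    (odd⇒1≤ r odd-r , ≤-trans (n≤2*⌈n/2⌉ r) (*-monoʳ-≤ 2 (≤-trans (proj₁ (InSkew⇒bounded la mu s)) (m≤m⊔n _ _)))) ,
    (odd⇒1≤ c odd-c , ≤-trans (n≤2*⌈n/2⌉ c) (*-monoʳ-≤ 2 (≤-trans (proj₂ (InSkew⇒bounded la mu s)) (m≤m⊔n _ _))))
  ... | inj₂ (even-r , even-c , s@(1≤r/2 , ρ<c/2 , _)) =
    (≤-trans 1≤r/2 (⌊n/2⌋≤n r) ,
     ≤-trans (even⇒n≤2*⌊n/2⌋ r even-r) (*-monoʳ-≤ 2 (≤-trans (proj₁ (InSkew⇒bounded nu rh s)) (m≤n⊔m (length la) _)))) ,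
    (≤-trans (<-≤-trans (s≤s z≤n) ρ<c/2) (⌊n/2⌋≤n c) ,
     ≤-trans (even⇒n≤2*⌊n/2⌋ c even-c) (*-monoʳ-≤ 2 (≤-trans (proj₂ (InSkew⇒bounded nu rh s)) (m≤n⊔m (maxL la) _))))

  row-cells : ℕ → List (ℕ × ℕ)
  row-cells r = map (r ,_) (filterᵇ (inD r) (reverse (range1 colBound)))

  cellsD-sorted : AllPairs _≺_ cellsD
  cellsD-sorted = AllPairs.concat⁺ (All.map⁺ (All.tabulate (λ {r} _ → within r)))
                                   (AllPairs.map⁺ (AllPairs.map across (range1-sorted rowBound)))
    where
    within : ∀ r → AllPairs _≺_ (row-cells r)
    within r = AllPairs.map⁺ (AllPairs.map (λ c'<c → inj₂ (refl , c'<c))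
                 (AllPairs-filterᵇ⁺ (inD r) (AllPairs-reverse⁺ (range1-sorted colBound))))
    across : ∀ {r r'} → r < r' → All (λ x → All (x ≺_) (row-cells r')) (row-cells r)
    across r<r' = All.map⁺ (All.tabulate (λ _ → All.map⁺ (All.tabulate (λ _ → inj₁ r<r'))))

  cellsD-inD : All (λ x → inD (proj₁ x) (proj₂ x) ≡ true) cellsD
  cellsD-inD = All.concat⁺ (All.map⁺ {xs = range1 rowBound} {f = row-cells}
                 (All.tabulate (λ {r} _ → All.map⁺ (all-filterᵇ (inD r) (reverse (range1 colBound))))))

  inD⇒∈cellsD : ∀ r c → inD r c ≡ true → (r , c) ∈ cellsD
  inD⇒∈cellsD r c h with inD-bounds r c h
  ... | (1≤r , r≤) , (1≤c , c≤) =
    ∈-concat⁺′ (∈-map⁺ (r ,_) (∈-filterᵇ⁺ (inD r) (Any.reverse⁺ (∈-range1⁺ 1≤c c≤)) h))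
               (∈-map⁺ row-cells (∈-range1⁺ 1≤r r≤))

  inD-down-left : IsPartition mu → IsPartition rh → ∀ r c c' →
    inD (2 + r) c ≡ true → inD r c' ≡ true → c' ≤ c → inD (2 + r) c' ≡ true
  inD-down-left pmu prh r c c' below at c'≤c with inD≡true⇒ r c' at | inD≡true⇒ (2 + r) c below
  ... | inj₁ (odd-r , odd-c' , (1≤ , μ<c' , _)) | inj₁ (_ , _ , (_ , _ , c≤λ)) =
    InD⇒inD≡true (2 + r) c' (inj₁ (odd-r , odd-c' , (s≤s z≤n , ≤-<-trans (pmu _ 1≤) μ<c' , ≤-trans (⌈n/2⌉-mono c'≤c) c≤λ)))
  ... | inj₂ (even-r , even-c' , (1≤ , ρ<c' , _)) | inj₂ (_ , _ , (_ , _ , c≤ν)) =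
    InD⇒inD≡true (2 + r) c' (inj₂ (even-r , even-c' , (s≤s z≤n , ≤-<-trans (prh _ 1≤) ρ<c' , ≤-trans (⌊n/2⌋-mono c'≤c) c≤ν)))
  ... | inj₁ (odd-r , _) | inj₂ (even-r , _) = ⊥-elim (not-¬ refl (trans (sym odd-r) even-r))
  ... | inj₂ (even-r , _) | inj₁ (odd-r , _) = ⊥-elim (not-¬ refl (trans (sym odd-r) even-r))

  inD-up-right : IsPartition la → IsPartition nu → ∀ r c c' →
    inD r c ≡ true → inD (2 + r) c' ≡ true → c ≤ c' → inD r c' ≡ true
  inD-up-right pla pnu r c c' at below c≤c' with inD≡true⇒ r c at | inD≡true⇒ (2 + r) c' below
  ... | inj₁ (odd-r , _ , (1≤ , μ<c , _)) | inj₁ (_ , odd-c' , (_ , _ , c'≤λ)) =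
    InD⇒inD≡true r c' (inj₁ (odd-r , odd-c' , (1≤ , <-≤-trans μ<c (⌈n/2⌉-mono c≤c') , ≤-trans c'≤λ (pla _ 1≤))))
  ... | inj₂ (even-r , _ , (1≤ , ρ<c , _)) | inj₂ (_ , even-c' , (_ , _ , c'≤ν)) =
    InD⇒inD≡true r c' (inj₂ (even-r , even-c' , (1≤ , <-≤-trans ρ<c (⌊n/2⌋-mono c≤c') , ≤-trans c'≤ν (pnu _ 1≤))))
  ... | inj₁ (odd-r , _) | inj₂ (even-r , _) = ⊥-elim (not-¬ refl (trans (sym odd-r) even-r))
  ... | inj₂ (even-r , _) | inj₁ (odd-r , _) = ⊥-elim (not-¬ refl (trans (sym odd-r) even-r))

module Labels (la mu nu rh : List ℕ) where
  open Shuffle la mu nu rh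
  open Diagram la mu nu rh

  opaque
    cellAt : ℕ → ℕ × ℕ
    cellAt = nthD (0 , 0) cellsD

    cellsD-by-label : cellsD ≡ map cellAt (interval 0 N)
    cellsD-by-label = map-nthD-interval (0 , 0) cellsD

    cellOf⇒cellAt : ∀ {k x} → cellOf k ≡ just x → cellAt k ≡ x
    cellOf⇒cellAt = cong (fromMaybe (0 , 0))

  row col : ℕ → ℕ
  row = proj₁ ∘ cellAt
  col = proj₂ ∘ cellAt

  Label : ℕ → Set
  Label = InInterval 0 N

  cellsD-split : ∀ {p} → p ≤ N → cellsD ≡ map cellAt (interval 0 p) ++ map cellAt (interval p (N ∸ p))
  cellsD-split {p} p≤N = begin
    cellsD                                          ≡⟨ cellsD-by-label ⟩
    map cellAt (interval 0 N)                       ≡⟨ cong (map cellAt ∘ interval 0) (m+[n∸m]≡n p≤N) ⟨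
    map cellAt (interval 0 (p + (N ∸ p)))           ≡⟨ cong (map cellAt) (interval-++ 0 p (N ∸ p)) ⟩
    map cellAt (interval 0 p ++ interval p (N ∸ p)) ≡⟨ map-++ cellAt (interval 0 p) _ ⟩
    map cellAt (interval 0 p) ++ map cellAt (interval p (N ∸ p)) ∎
    where open ≡-Reasoning

  label-inD : ∀ {k} → Label k → inD (row k) (col k) ≡ true
  label-inD {k} k∈ =
    All.lookup cellsD-inD (subst (cellAt k ∈_) (sym cellsD-by-label) (∈-map⁺ cellAt (∈-interval⁺ k∈)))

  label-parity : ∀ {k} → Label k → isOdd (row k) ≡ isOdd (col k)
  label-parity {k} k∈ = inD-parity (row k) (col k) (label-inD k∈)

  label<⇒≺ : ∀ {k k'} → Label k → Label k' → k < k' → cellAt k ≺ cellAt k'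
  label<⇒≺ = AllPairs-interval (AllPairs.map⁻ (subst (AllPairs _≺_) cellsD-by-label cellsD-sorted))

  ≺⇒label< : ∀ {k k'} → Label k → Label k' → cellAt k ≺ cellAt k' → k < k'
  ≺⇒label< {k} {k'} k∈ k'∈ k≺k' with <-cmp k k'
  ... | tri< k<k' _ _ = k<k'
  ... | tri≈ _ refl _ = ⊥-elim (≺-irrefl k≺k')
  ... | tri> _ _ k'<k = ⊥-elim (≺-asym k≺k' (label<⇒≺ k'∈ k∈ k'<k))

  label-injective : ∀ {k k'} → Label k → Label k' → row k ≡ row k' → col k ≡ col k' → k ≡ k'
  label-injective {k} {k'} k∈ k'∈ r≡ c≡ with <-cmp k k'
  ... | tri≈ _ k≡k' _ = k≡k'
  ... | tri< k<k' _ _ =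
    ⊥-elim (≺-irrefl (subst₂ (λ r c → cellAt k ≺ (r , c)) (sym r≡) (sym c≡) (label<⇒≺ k∈ k'∈ k<k')))
  ... | tri> _ _ k'<k =
    ⊥-elim (≺-irrefl (subst₂ (λ r c → cellAt k' ≺ (r , c)) r≡ c≡ (label<⇒≺ k'∈ k∈ k'<k)))

  label≤⇒row≤ : ∀ {k k'} → Label k → Label k' → k ≤ k' → row k ≤ row k'
  label≤⇒row≤ k∈ k'∈ k≤k' with m≤n⇒m<n∨m≡n k≤k'
  ... | inj₂ refl = ≤-refl
  ... | inj₁ k<k' with label<⇒≺ k∈ k'∈ k<k'
  ...   | inj₁ r<r'      = <⇒≤ r<r'
  ...   | inj₂ (r≡r' , _) = ≤-reflexive r≡r'

  same-row-label<⇒col> : ∀ {k k'} → Label k → Label k' → row k ≡ row k' → k < k' → col k' < col k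
  same-row-label<⇒col> k∈ k'∈ r≡r' k<k' with label<⇒≺ k∈ k'∈ k<k'
  ... | inj₁ r<r'       = ⊥-elim (<-irrefl r≡r' r<r')
  ... | inj₂ (_ , c'<c) = c'<c

  same-row-label≤⇒col≥ : ∀ {k k'} → Label k → Label k' → row k ≡ row k' → k ≤ k' → col k' ≤ col k
  same-row-label≤⇒col≥ k∈ k'∈ r≡r' k≤k' with m≤n⇒m<n∨m≡n k≤k'
  ... | inj₂ refl = ≤-refl
  ... | inj₁ k<k' = <⇒≤ (same-row-label<⇒col> k∈ k'∈ r≡r' k<k')

  same-row-col≤⇒label≥ : ∀ {k k'} → Label k → Label k' → row k ≡ row k' → col k ≤ col k' → k' ≤ k
  same-row-col≤⇒label≥ {k} {k'} k∈ k'∈ r≡r' c≤c' with m≤n⇒m<n∨m≡n c≤c'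
  ... | inj₂ c≡c' = ≤-reflexive (label-injective k'∈ k∈ (sym r≡r') (sym c≡c'))
  ... | inj₁ c<c' = <⇒≤ (≺⇒label< k'∈ k∈ (inj₂ (sym r≡r' , c<c')))

  row<⇒label< : ∀ {k k'} → Label k → Label k' → row k < row k' → k < k'
  row<⇒label< k∈ k'∈ r<r' = ≺⇒label< k∈ k'∈ (inj₁ r<r')

  cellOf⇒label : ∀ {k r c} → cellOf k ≡ just (r , c) → Label k × row k ≡ r × col k ≡ c
  cellOf⇒label {k} h = nth≡just⇒bounds cellsD k h , cong proj₁ (cellOf⇒cellAt h) , cong proj₂ (cellOf⇒cellAt h)

  inD⇒label : ∀ r c → inD r c ≡ true → ∃[ k ] Label k × row k ≡ r × col k ≡ c
  inD⇒label r c h with ∈-map⁻ cellAt (subst ((r , c) ∈_) cellsD-by-label (inD⇒∈cellsD r c h))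
  ... | k , k∈ , rc≡ = k , ∈-interval⁻ k∈ , cong proj₁ (sym rc≡) , cong proj₂ (sym rc≡)

overlap-test : ∀ w c c' a b → c ≡ c' → (a ≡ w × b ≡ suc w) ⊎ (a ≡ suc w × b ≡ w) →
  ((c ≡ᵇ c') ∧ (((a ≡ᵇ w) ∧ (b ≡ᵇ suc w)) ∨ ((a ≡ᵇ suc w) ∧ (b ≡ᵇ w)))) ≡ true
overlap-test w c _ _ _ refl (inj₁ (refl , refl)) rewrite ≡⇒≡ᵇ≡true {c} refl | ≡⇒≡ᵇ≡true {w} refl = refl
overlap-test w c _ _ _ refl (inj₂ (refl , refl)) rewrite ≡⇒≡ᵇ≡true {c} refl | ≡⇒≡ᵇ≡true {w} refl = ∨-zeroʳ _

select-upper : ∀ x y o → ((x ∨ y) ∧ not o) ∧ y ≡ y ∧ not o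
select-upper false false o     = refl
select-upper false true  o     = ∧-comm (not o) true
select-upper true  false o     = ∧-zeroʳ (not o)
select-upper true  true  o     = ∧-comm (not o) true

select-lower : ∀ x y o → (x ≡ true → y ≡ false) → ((x ∨ y) ∧ not o) ∧ not y ≡ x ∧ not o
select-lower false false o _   = refl
select-lower false true  o _   = ∧-zeroʳ (not o)
select-lower true  false o _   = ∧-identityʳ (not o)
select-lower true  true  o x⇒¬y with x⇒¬y refl
... | ()

module Tableau (la mu nu rh : List ℕ) (S : ℕ → ℕ → ℕ) (ST : Shuffle.IsShuffleTableau la mu nu rh S) where
  open Shuffle la mu nu rh
  open Diagram la mu nu rh
  open Labels la mu nu rh

  val : ℕ → ℕ
  val k = S (row k) (col k)

  val-pos : ∀ {k} → Label k → 1 ≤ val k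
  val-pos k∈ = proj₁ ST _ _ (label-inD k∈)

  val-row-mono : ∀ {k k'} → Label k → Label k' → row k ≡ row k' → col k ≤ col k' → val k ≤ val k'
  val-row-mono {k} {k'} k∈ k'∈ r≡ c≤ with m≤n⇒m<n∨m≡n c≤
  ... | inj₂ c≡ = ≤-reflexive (cong₂ S r≡ c≡)
  ... | inj₁ c< = subst (λ r → val k ≤ S r (col k')) r≡
                    (proj₁ (proj₂ ST) _ _ _ (label-inD k∈)
                                          (subst (λ r → inD r (col k') ≡ true) (sym r≡) (label-inD k'∈)) c<)

  val-row-antitone : ∀ {k k'} → Label k → Label k' → row k ≡ row k' → k ≤ k' → val k' ≤ val k
  val-row-antitone k∈ k'∈ r≡ k≤k' with m≤n⇒m<n∨m≡n k≤k'
  ... | inj₂ refl = ≤-refl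
  ... | inj₁ k<k' = val-row-mono k'∈ k∈ (sym r≡) (<⇒≤ (same-row-label<⇒col> k∈ k'∈ r≡ k<k'))

  val-col-strict : ∀ {k k'} → Label k → Label k' → col k ≡ col k' → row k < row k' → val k < val k'
  val-col-strict {k} {k'} k∈ k'∈ c≡ r< = subst (λ c → val k < S (row k') c) c≡
    (proj₂ (proj₂ ST) _ _ _ (label-inD k∈) (subst (λ c → inD (row k') c ≡ true) (sym c≡) (label-inD k'∈)) r<)

  same-col-same-val⇒≡ : ∀ {k k'} → Label k → Label k' → col k ≡ col k' → val k ≡ val k' → k ≡ k'
  same-col-same-val⇒≡ {k} {k'} k∈ k'∈ c≡ v≡ with <-cmp (row k) (row k')
  ... | tri< r< _ _ = ⊥-elim (<-irrefl v≡ (val-col-strict k∈ k'∈ c≡ r<))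
  ... | tri≈ _ r≡ _ = label-injective k∈ k'∈ r≡ c≡
  ... | tri> _ _ r> = ⊥-elim (<-irrefl (sym v≡) (val-col-strict k'∈ k∈ (sym c≡) r>))

  hasVal : ℕ → ℕ → Bool
  hasVal v k = val k ≡ᵇ v

  -- occ (val k) k is the column of label k in φ⁻¹(S).
  occ : ℕ → ℕ → ℕ
  occ v = count (hasVal v) 0

  overlapped : ℕ → ℕ → Bool
  overlapped w k = inOverlap S w (cellAt k)

  Partners : ℕ → ℕ → ℕ → Set
  Partners w k k' = col k' ≡ col k × ((val k ≡ w × val k' ≡ suc w) ⊎ (val k ≡ suc w × val k' ≡ w))

  overlapped⇒partner : ∀ w k → overlapped w k ≡ true → ∃[ k' ] Label k' × Partners w k k'
  overlapped⇒partner w k h with anyᵇ≡true⇒ _ cellsD h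
  ... | x , x∈ , px with ∈-map⁻ cellAt (subst (x ∈_) cellsD-by-label x∈)
  ...   | k' , k'∈ , refl with ∧≡true⇒ px
  ...     | c≡ , vals = k' , ∈-interval⁻ k'∈ , ≡ᵇ≡true⇒≡ c≡ , decode (∨≡true⇒ vals)
    where
    decode : ∀ {a b} → ((a ≡ᵇ w) ∧ (b ≡ᵇ suc w)) ≡ true ⊎ ((a ≡ᵇ suc w) ∧ (b ≡ᵇ w)) ≡ true →
             (a ≡ w × b ≡ suc w) ⊎ (a ≡ suc w × b ≡ w)
    decode (inj₁ h′) = inj₁ (≡ᵇ≡true⇒≡ (proj₁ (∧≡true⇒ h′)) , ≡ᵇ≡true⇒≡ (proj₂ (∧≡true⇒ h′)))
    decode (inj₂ h′) = inj₂ (≡ᵇ≡true⇒≡ (proj₁ (∧≡true⇒ h′)) , ≡ᵇ≡true⇒≡ (proj₂ (∧≡true⇒ h′)))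

  partner⇒overlapped : ∀ w k k' → Label k' → Partners w k k' → overlapped w k ≡ true
  partner⇒overlapped w k k' k'∈ (c≡ , vals) =
    ∈⇒anyᵇ≡true _ (subst (cellAt k' ∈_) (sym cellsD-by-label) (∈-map⁺ cellAt (∈-interval⁺ k'∈)))
                  (overlap-test w (col k') (col k) (val k) (val k') c≡ vals)

  overlappedWith freeWith : ℕ → ℕ → ℕ → Bool
  overlappedWith w v k = hasVal v k ∧ overlapped w k
  freeWith       w v k = hasVal v k ∧ not (overlapped w k)

  count-hasVal-split : ∀ w v o n → count (hasVal v) o n ≡ count (overlappedWith w v) o n + count (freeWith w v) o n
  count-hasVal-split w v = count-∧-split (hasVal v) (overlapped w)

  freeWith≡true⇒ : ∀ {w v k} → freeWith w v k ≡ true → val k ≡ v × overlapped w k ≡ false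
  freeWith≡true⇒ {w} {v} {k} h with ∧≡true⇒ {hasVal v k} h
  ... | vk , not-ovl = ≡ᵇ≡true⇒≡ vk , not-injective not-ovl

  upper-partner : ∀ w k → Label k → val k ≡ suc w → overlapped w k ≡ true →
    ∃[ k' ] Label k' × col k' ≡ col k × row k' < row k × val k' ≡ w
  upper-partner w k k∈ vk ovl with overlapped⇒partner w k ovl
  ... | k' , k'∈ , c≡ , inj₁ (vk≡w , _) = ⊥-elim (1+n≢n (trans (sym vk) vk≡w))
  ... | k' , k'∈ , c≡ , inj₂ (_ , vk'≡w) = k' , k'∈ , c≡ , above , vk'≡w
    where
    above : row k' < row k
    above with <-cmp (row k') (row k)
    ... | tri< r< _ _ = r<
    ... | tri≈ _ r≡ _ =
      ⊥-elim (1+n≢n (trans (sym vk) (trans (cong val (label-injective k∈ k'∈ (sym r≡) (sym c≡))) vk'≡w)))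
    ... | tri> _ _ r> = ⊥-elim (<-asym (n<1+n w) (subst₂ _<_ vk vk'≡w (val-col-strict k∈ k'∈ (sym c≡) r>)))

  overlapped-lattice : ∀ w p m → p ≤ N →
    (∀ {k k'} → Label k → k ≤ p → Label k' → col k' ≡ col k → row k' < row k → k' ≤ m) →
    count (overlappedWith w (suc w)) 0 p ≤ count (overlappedWith w w) 0 m
  overlapped-lattice w p m p≤N above⇒≤m = count-injection R 0 p 0 m partner R-injective
    where
    R : ℕ → ℕ → Set
    R k k' = Label k × col k' ≡ col k × val k ≡ suc w
    partner : ∀ k → InInterval 0 p k → overlappedWith w (suc w) k ≡ true →
              ∃[ k' ] R k k' × InInterval 0 m k' × overlappedWith w w k' ≡ true
    partner k (0<k , k≤p) h with ∧≡true⇒ h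
    ... | vk , ovl with upper-partner w k (0<k , ≤-trans k≤p p≤N) (≡ᵇ≡true⇒≡ vk) ovl
    ...   | k' , k'∈ , c≡ , r< , vk' =
      k' , (k∈ , c≡ , ≡ᵇ≡true⇒≡ vk) , (proj₁ k'∈ , above⇒≤m k∈ k≤p k'∈ c≡ r<) ,
      ∧-≡true (≡⇒≡ᵇ≡true vk') ovl′
      where
      k∈ : Label k
      k∈ = 0<k , ≤-trans k≤p p≤N
      ovl′ : overlapped w k' ≡ true
      ovl′ = partner⇒overlapped w k' k k∈ (sym c≡ , inj₁ (vk' , ≡ᵇ≡true⇒≡ vk))
    R-injective : ∀ {k₁ k₂ k'} → R k₁ k' → R k₂ k' → k₁ ≡ k₂
    R-injective (k₁∈ , c₁ , v₁) (k₂∈ , c₂ , v₂) =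
      same-col-same-val⇒≡ k₁∈ k₂∈ (trans (sym c₁) c₂) (trans v₁ (sym v₂))

  module ReadingWord (w : ℕ) where

    opens keep : ℕ × ℕ → Bool
    opens x = S (proj₁ x) (proj₂ x) ≡ᵇ suc w
    keep  x = ((S (proj₁ x) (proj₂ x) ≡ᵇ w) ∨ (S (proj₁ x) (proj₂ x) ≡ᵇ suc w)) ∧ not (inOverlap S w x)

    word-of : List ℕ → List Bool
    word-of ks = map opens (filterᵇ keep (reverse (map cellAt ks)))

    readingWord-split : ∀ {p} → p ≤ N → readingWord S w ≡ word-of (interval p (N ∸ p)) ++ word-of (interval 0 p)
    readingWord-split {p} p≤N = begin
      map opens (filterᵇ keep (reverse cellsD))
        ≡⟨ cong (map opens ∘ filterᵇ keep ∘ reverse) (cellsD-split p≤N) ⟩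
      map opens (filterᵇ keep (reverse (early ++ late)))
        ≡⟨ cong (map opens ∘ filterᵇ keep) (reverse-++ early late) ⟩
      map opens (filterᵇ keep (reverse late ++ reverse early))
        ≡⟨ cong (map opens) (filterᵇ-++ keep (reverse late) (reverse early)) ⟩
      map opens (filterᵇ keep (reverse late) ++ filterᵇ keep (reverse early))
        ≡⟨ map-++ opens (filterᵇ keep (reverse late)) _ ⟩
      word-of (interval p (N ∸ p)) ++ word-of (interval 0 p) ∎
      where
      open ≡-Reasoning
      early late : List (ℕ × ℕ)
      early = map cellAt (interval 0 p)
      late  = map cellAt (interval p (N ∸ p))

    countL-word-of : ∀ Q p →
      countL Q (word-of (interval 0 p)) ≡ count (λ k → keep (cellAt k) ∧ Q (opens (cellAt k))) 0 p
    countL-word-of Q p = begin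
      countL Q (word-of (interval 0 p))
        ≡⟨ countL-map-filterᵇ-reverse Q opens keep (map cellAt (interval 0 p)) ⟩
      countL (λ x → keep x ∧ Q (opens x)) (map cellAt (interval 0 p))
        ≡⟨ countL-map _ cellAt (interval 0 p) ⟩
      countL (λ k → keep (cellAt k) ∧ Q (opens (cellAt k))) (interval 0 p)
        ≡⟨ countL-interval _ 0 p ⟩
      count (λ k → keep (cellAt k) ∧ Q (opens (cellAt k))) 0 p ∎
      where open ≡-Reasoning

  module _ (Y : IsYamanouchi S) where

    -- The labels ≤ p are read last, so they spell a suffix of the Yamanouchi word.
    free-lattice : ∀ w → 1 ≤ w → ∀ p → p ≤ N → count (freeWith w (suc w)) 0 p ≤ count (freeWith w w) 0 p
    free-lattice w 1≤w p p≤N =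
      subst₂ _≤_ (trans (countL-word-of id p) (count-cong 0 p upper))
                 (trans (countL-word-of not p) (count-cong 0 p lower))
                 (balanced⇒suffix-opens≤closes (word-of (interval p (N ∸ p))) (word-of (interval 0 p))
                   (trans (cong (unmatchedOpen 0) (sym (readingWord-split p≤N))) (Y w 1≤w)))
      where
      open ReadingWord w
      upper : ∀ k → InInterval 0 p k → (keep (cellAt k) ∧ opens (cellAt k)) ≡ freeWith w (suc w) k
      upper k _ = select-upper (val k ≡ᵇ w) (val k ≡ᵇ suc w) (overlapped w k)
      lower : ∀ k → InInterval 0 p k → (keep (cellAt k) ∧ not (opens (cellAt k))) ≡ freeWith w w k
      lower k _ = select-lower (val k ≡ᵇ w) (val k ≡ᵇ suc w) (overlapped w k)
                    (λ h → ≢⇒≡ᵇ≡false {val k} {suc w} (λ e → 1+n≢n (trans (sym e) (≡ᵇ≡true⇒≡ h))))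

    lattice : ∀ v → 1 ≤ v → ∀ p → p ≤ N → occ (suc v) p ≤ occ v p
    lattice v 1≤v p p≤N = begin
      occ (suc v) p
        ≡⟨ count-hasVal-split v (suc v) 0 p ⟩
      count (overlappedWith v (suc v)) 0 p + count (freeWith v (suc v)) 0 p
        ≤⟨ +-mono-≤ (overlapped-lattice v p p p≤N above-is-earlier) (free-lattice v 1≤v p p≤N) ⟩
      count (overlappedWith v v) 0 p + count (freeWith v v) 0 p
        ≡⟨ count-hasVal-split v v 0 p ⟨
      occ v p ∎
      where
      open ≤-Reasoning
      above-is-earlier : ∀ {k k'} → Label k → k ≤ p → Label k' → col k' ≡ col k → row k' < row k → k' ≤ p
      above-is-earlier k∈ k≤p k'∈ _ r< = <⇒≤ (<-≤-trans (row<⇒label< k'∈ k∈ r<) k≤p)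

    lattice-antitone : ∀ {v v'} → 1 ≤ v → v ≤ v' → ∀ p → p ≤ N → occ v' p ≤ occ v p
    lattice-antitone {v} {zero}   1≤v v≤0 p p≤N = ⊥-elim (<⇒≱ 1≤v v≤0)
    lattice-antitone {v} {suc v'} 1≤v v≤  p p≤N with m≤n⇒m<n∨m≡n v≤
    ... | inj₂ refl       = ≤-refl
    ... | inj₁ (s≤s v≤v') = ≤-trans (lattice v' (≤-trans 1≤v v≤v') p p≤N) (lattice-antitone 1≤v v≤v' p p≤N)

    module VerticalPair (pla : IsPartition la) (pmu : IsPartition mu) (pnu : IsPartition nu) (prh : IsPartition rh)
                        {i j} (i∈ : Label i) (j∈ : Label j) (cj≡ci : col j ≡ col i) (rj≡ : row j ≡ 2 + row i) where

      r c u w : ℕ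
      r = row i
      c = col i
      u = val i
      w = val j

      r<2+r : r < 2 + r
      r<2+r = m<n+m r (s≤s z≤n)

      u<w : u < w
      u<w = val-col-strict i∈ j∈ (sym cj≡ci) (subst (r <_) (sym rj≡) r<2+r)

      middle-label : ∀ {k} → i < k → k ≤ j → Label k
      middle-label i<k k≤j = <-≤-trans (s≤s z≤n) i<k , ≤-trans k≤j (proj₂ j∈)

      MiddleCell : ℕ → Set
      MiddleCell k = (row k ≡ r × col k < c) ⊎ row k ≡ suc r ⊎ (row k ≡ 2 + r × c ≤ col k)

      middle-cells : ∀ {k} → i < k → k ≤ j → MiddleCell k
      middle-cells {k} i<k k≤j with label<⇒≺ i∈ (middle-label i<k k≤j) i<k
      ... | inj₂ (r≡ , ck<c) = inj₁ (sym r≡ , ck<c)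
      ... | inj₁ r<rk with m≤n⇒m<n∨m≡n k≤j
      ...   | inj₂ refl = inj₂ (inj₂ (rj≡ , ≤-reflexive (sym cj≡ci)))
      ...   | inj₁ k<j with label<⇒≺ (middle-label i<k k≤j) j∈ k<j
      ...     | inj₁ rk<rj          = inj₂ (inj₁ (≤-antisym (≤-pred (subst (row k <_) rj≡ rk<rj)) r<rk))
      ...     | inj₂ (rk≡rj , cj<ck) = inj₂ (inj₂ (trans rk≡rj rj≡ , subst (_≤ col k) cj≡ci (<⇒≤ cj<ck)))

      -- All squares of a column have the parity of that column, so a square strictly above one in
      -- row ≤ r + 2 lies in row ≤ r.
      above-is-before-i : ∀ {k k'} → Label k → k ≤ j → Label k' → col k' ≡ col k → row k' < row k → k' ≤ i
      above-is-before-i {k} {k'} k∈ k≤j k'∈ c≡ rk'<rk = by-row (m≤n⇒m<n∨m≡n rk'≤r)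
        where
        gap : 2 + row k' ≤ row k
        gap = same-parity⇒2+≤ rk'<rk (trans (label-parity k'∈) (trans (cong odd? c≡) (sym (label-parity k∈))))
        rk≤ : row k ≤ 2 + r
        rk≤ = subst (row k ≤_) rj≡ (label≤⇒row≤ k∈ j∈ k≤j)
        rk'≤r : row k' ≤ r
        rk'≤r = +-cancelˡ-≤ 2 _ _ (≤-trans gap rk≤)
        by-row : row k' < r ⊎ row k' ≡ r → k' ≤ i
        by-row (inj₁ rk'<r) = <⇒≤ (row<⇒label< k'∈ i∈ rk'<r)
        by-row (inj₂ rk'≡r) = same-row-col≤⇒label≥ i∈ k'∈ (sym rk'≡r) c≤ck'
          where
          rk≡ : row k ≡ 2 + r
          rk≡ = ≤-antisym rk≤ (subst (λ z → 2 + z ≤ row k) rk'≡r gap)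
          c≤ck' : c ≤ col k'
          c≤ck' = subst₂ _≤_ cj≡ci (sym c≡) (same-row-label≤⇒col≥ k∈ j∈ (trans rk≡ (sym rj≡)) k≤j)

      cell-above : ∀ {k} → Label k → row k ≡ 2 + r → c ≤ col k →
        ∃[ k' ] Label k' × row k' ≡ r × col k' ≡ col k × u ≤ val k' × val k' < val k × k' ≤ i
      cell-above {k} k∈ rk≡ c≤ck = compare-values (inD⇒label r (col k) above-in-D)
        where
        above-in-D : inD r (col k) ≡ true
        above-in-D = inD-up-right pla pnu r c (col k) (label-inD i∈)
                                  (subst (λ z → inD z (col k) ≡ true) rk≡ (label-inD k∈)) c≤ck
        compare-values : (∃[ k' ] Label k' × row k' ≡ r × col k' ≡ col k) →
          ∃[ k' ] Label k' × row k' ≡ r × col k' ≡ col k × u ≤ val k' × val k' < val k × k' ≤ i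
        compare-values (k' , k'∈ , rk' , ck') =
          k' , k'∈ , rk' , ck' ,
          val-row-mono i∈ k'∈ (sym rk') (subst (c ≤_) (sym ck') c≤ck) ,
          val-col-strict k'∈ k∈ ck' (subst₂ _<_ (sym rk') (sym rk≡) r<2+r) ,
          same-row-col≤⇒label≥ i∈ k'∈ (sym rk') (subst (c ≤_) (sym ck') c≤ck)

      cell-below : ∀ {k} → Label k → row k ≡ r → col k ≤ c →
        ∃[ k' ] Label k' × col k' ≡ col k × val k < val k' × val k' ≤ w
      cell-below {k} k∈ rk≡ ck≤c = compare-values (inD⇒label (2 + r) (col k) below-in-D)
        where
        below-in-D : inD (2 + r) (col k) ≡ true
        below-in-D = inD-down-left pmu prh r c (col k) (subst₂ (λ a b → inD a b ≡ true) rj≡ cj≡ci (label-inD j∈))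
                                   (subst (λ z → inD z (col k) ≡ true) rk≡ (label-inD k∈)) ck≤c
        compare-values : (∃[ k' ] Label k' × row k' ≡ 2 + r × col k' ≡ col k) →
          ∃[ k' ] Label k' × col k' ≡ col k × val k < val k' × val k' ≤ w
        compare-values (k' , k'∈ , rk' , ck') =
          k' , k'∈ , ck' ,
          val-col-strict k∈ k'∈ (sym ck') (subst₂ _<_ (sym rk≡) (sym rk') r<2+r) ,
          val-row-mono k'∈ j∈ (trans rk' (sym rj≡)) (subst₂ _≤_ (sym ck') (sym cj≡ci) ck≤c)

      free-cell-above : ∀ {k v} → Label k → row k ≡ 2 + r → c ≤ col k → val k ≡ suc v → overlapped v k ≡ false →
        ∃[ k' ] Label k' × row k' ≡ r × col k' ≡ col k × u ≤ val k' × val k' < v × k' ≤ i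
      free-cell-above {k} {v} k∈ rk≡ c≤ck vk not-ovl = strictly-below (cell-above k∈ rk≡ c≤ck)
        where
        strictly-below : (∃[ k' ] Label k' × row k' ≡ r × col k' ≡ col k × u ≤ val k' × val k' < val k × k' ≤ i) →
          ∃[ k' ] Label k' × row k' ≡ r × col k' ≡ col k × u ≤ val k' × val k' < v × k' ≤ i
        strictly-below (k' , k'∈ , rk' , ck' , u≤ , vk'<vk , k'≤i) =
          k' , k'∈ , rk' , ck' , u≤ , ≤∧≢⇒< (≤-pred (subst (val k' <_) vk vk'<vk)) not-partner , k'≤i
          where
          not-partner : val k' ≢ v
          not-partner vk'≡v =
            false≢true (trans (sym not-ovl) (partner⇒overlapped v k k' k'∈ (ck' , inj₂ (vk , vk'≡v))))

      1≤u : 1 ≤ u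
      1≤u = val-pos i∈

      i≤N : i ≤ N
      i≤N = proj₂ i∈

      j≤N : j ≤ N
      j≤N = proj₂ j∈

      Left Right : ℕ → ℕ → Set
      Left  θ k = (row k ≡ r × col k < c) ⊎ (row k ≡ suc r × θ ≤ val k)
      Right θ k = (row k ≡ 2 + r × c ≤ col k) ⊎ (row k ≡ suc r × val k < θ)

      late : ℕ → ℕ → Bool
      late θ k = (row k ≡ᵇ 2 + r) ∨ ((row k ≡ᵇ suc r) ∧ (val k <ᵇ θ))

      late-row₂ : ∀ θ {k} → row k ≡ 2 + r → late θ k ≡ true
      late-row₂ θ rk rewrite ≡⇒≡ᵇ≡true rk = refl

      late-row₁ : ∀ θ {k} → row k ≡ suc r → val k < θ → late θ k ≡ true
      late-row₁ θ {k} rk vk<θ =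
        trans (cong ((row k ≡ᵇ 2 + r) ∨_) (∧-≡true (≡⇒≡ᵇ≡true rk) (<⇒<ᵇ≡true vk<θ))) (∨-zeroʳ _)

      late⇒Right : ∀ θ {k} → Label k → k ≤ j → late θ k ≡ true → Right θ k
      late⇒Right θ {k} k∈ k≤j h with ∨≡true⇒ h
      ... | inj₁ rk≡ = inj₁ (≡ᵇ≡true⇒≡ rk≡ ,
                             subst (_≤ col k) cj≡ci (same-row-label≤⇒col≥ k∈ j∈ (trans (≡ᵇ≡true⇒≡ rk≡) (sym rj≡)) k≤j))
      ... | inj₂ h′ = inj₂ (≡ᵇ≡true⇒≡ (proj₁ (∧≡true⇒ h′)) , <ᵇ≡true⇒< (proj₂ (∧≡true⇒ h′)))

      not-late⇒Left : ∀ θ {k} → i < k → k ≤ j → late θ k ≡ false → Left θ k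
      not-late⇒Left θ {k} i<k k≤j h with middle-cells i<k k≤j
      ... | inj₁ in-row-r          = inj₁ in-row-r
      ... | inj₂ (inj₂ (rk≡ , _)) = ⊥-elim (false≢true (trans (sym h) (late-row₂ θ rk≡)))
      ... | inj₂ (inj₁ rk≡) with val k <? θ
      ...   | yes vk<θ = ⊥-elim (false≢true (trans (sym h) (late-row₁ θ rk≡ vk<θ)))
      ...   | no  vk≮θ = inj₂ (rk≡ , ≮⇒≥ vk≮θ)

      late-upward : ∀ θ k k' → i < k → k ≤ k' → k' ≤ j → late θ k ≡ true → late θ k' ≡ true
      late-upward θ k k' i<k k≤k' k'≤j h = by-rows (middle-cells i<k' k'≤j) (late⇒Right θ k∈ k≤j h)
        where
        i<k' = <-≤-trans i<k k≤k'
        k≤j  = ≤-trans k≤k' k'≤j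
        k∈   = middle-label i<k k≤j
        k'∈  = middle-label i<k' k'≤j
        rk≤rk' : row k ≤ row k'
        rk≤rk' = label≤⇒row≤ k∈ k'∈ k≤k'
        by-rows : MiddleCell k' → Right θ k → late θ k' ≡ true
        by-rows (inj₂ (inj₂ (rk'≡ , _))) _                   = late-row₂ θ rk'≡
        by-rows (inj₁ (rk'≡ , _))        (inj₁ (rk≡ , _))    = ⊥-elim (<⇒≱ r<2+r (subst₂ _≤_ rk≡ rk'≡ rk≤rk'))
        by-rows (inj₁ (rk'≡ , _))        (inj₂ (rk≡ , _))    = ⊥-elim (1+n≰n (subst₂ _≤_ rk≡ rk'≡ rk≤rk'))
        by-rows (inj₂ (inj₁ rk'≡))       (inj₁ (rk≡ , _))    = ⊥-elim (1+n≰n (subst₂ _≤_ rk≡ rk'≡ rk≤rk'))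
        by-rows (inj₂ (inj₁ rk'≡))       (inj₂ (rk≡ , vk<θ)) =
          late-row₁ θ rk'≡ (≤-<-trans (val-row-antitone k∈ k'∈ (trans rk≡ (sym rk'≡)) k≤k') vk<θ)

      -- Between i and j the labels run through row r left of c, then row r + 1 from right to left
      -- (values weakly decreasing), then row r + 2 right of c; cut row r + 1 at the value θ.
      record Split (θ : ℕ) : Set where
        field
          t m   : ℕ
          j≡    : j ≡ i + t + m
          left  : ∀ k → InInterval i t k → i < k × k ≤ j × Left θ k
          right : ∀ k → InInterval (i + t) m k → i < k × k ≤ j × Right θ k

        i+t≤N : i + t ≤ N
        i+t≤N = ≤-trans (m≤m+n (i + t) m) (subst (_≤ N) j≡ j≤N)

      split : ∀ θ → Split θ
      split θ = from-cut (upward-closed-split (late θ) i (j ∸ i)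
                            (λ k k' i<k k≤k' k'≤ → late-upward θ k k' i<k k≤k' (subst (k' ≤_) j∸i-fits k'≤)))
        where
        j∸i-fits : i + (j ∸ i) ≡ j
        j∸i-fits = m+[n∸m]≡n (<⇒≤ (row<⇒label< i∈ j∈ (subst (r <_) (sym rj≡) r<2+r)))
        from-cut : (∃[ t ] ∃[ m ] t + m ≡ j ∸ i × (∀ k → InInterval i t k → late θ k ≡ false)
                                              × (∀ k → InInterval (i + t) m k → late θ k ≡ true)) → Split θ
        from-cut (t , m , t+m≡ , not-late , is-late) = record { t = t ; m = m ; j≡ = j≡ ; left = left ; right = right }
          where
          j≡ : j ≡ i + t + m
          j≡ = trans (sym j∸i-fits) (trans (cong (i +_) (sym t+m≡)) (sym (+-assoc i t m)))
          left : ∀ k → InInterval i t k → i < k × k ≤ j × Left θ k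
          left k k∈@(i<k , k≤) = i<k , k≤j , not-late⇒Left θ i<k k≤j (not-late k k∈)
            where
            k≤j = ≤-trans k≤ (subst (i + t ≤_) (sym j≡) (m≤m+n (i + t) m))
          right : ∀ k → InInterval (i + t) m k → i < k × k ≤ j × Right θ k
          right k k∈@(i+t<k , k≤) = i<k , k≤j , late⇒Right θ (middle-label i<k k≤j) k≤j (is-late k k∈)
            where
            i<k = ≤-<-trans (m≤m+n i t) i+t<k
            k≤j = subst (k ≤_) (sym j≡) k≤


      far-apart : ∀ x → u < x → w ≡ 2 + x → occ w j ≤ occ u i
      far-apart x u<x w≡ = begin
        occ w j                 ≡⟨ cong (λ v → occ v j) w≡ ⟩
        occ (2 + x) j           ≤⟨ lattice (suc x) (s≤s z≤n) j j≤N ⟩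
        occ (1 + x) j           ≡⟨ cong (occ (1 + x)) j≡ ⟩
        occ (1 + x) (i + t + m) ≡⟨ count-+-none (hasVal (1 + x)) 0 (i + t) m no-1+x-right ⟩
        occ (1 + x) (i + t)     ≤⟨ lattice x (≤-trans 1≤u (<⇒≤ u<x)) (i + t) i+t≤N ⟩
        occ x (i + t)           ≡⟨ count-+-none (hasVal x) 0 i t no-x-left ⟩
        occ x i                 ≤⟨ lattice-antitone 1≤u (<⇒≤ u<x) i i≤N ⟩
        occ u i                 ∎
        where
        open ≤-Reasoning
        open Split (split (suc x))
        no-1+x-right : ∀ k → InInterval (i + t) m k → hasVal (1 + x) k ≡ true → ⊥
        no-1+x-right k k∈ h = excluded (right k k∈)
          where
          excluded : i < k × k ≤ j × Right (suc x) k → ⊥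
          excluded (i<k , k≤j , inj₁ (rk≡ , _)) =
            <-irrefl (sym (≡ᵇ≡true⇒≡ h)) (<-≤-trans (subst (suc x <_) (sym w≡) ≤-refl)
                                               (val-row-antitone (middle-label i<k k≤j) j∈ (trans rk≡ (sym rj≡)) k≤j))
          excluded (_ , _ , inj₂ (_ , vk<)) = <-irrefl (≡ᵇ≡true⇒≡ h) vk<
        no-x-left : ∀ k → InInterval i t k → hasVal x k ≡ true → ⊥
        no-x-left k k∈ h = excluded (left k k∈)
          where
          excluded : i < k × k ≤ j × Left (suc x) k → ⊥
          excluded (i<k , k≤j , inj₁ (rk≡ , _)) =
            <-irrefl (≡ᵇ≡true⇒≡ h) (≤-<-trans (val-row-antitone i∈ (middle-label i<k k≤j) (sym rk≡) (<⇒≤ i<k)) u<x)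
          excluded (_ , _ , inj₂ (_ , x<vk)) = <-irrefl (sym (≡ᵇ≡true⇒≡ h)) x<vk

      adjacent : w ≡ suc u → occ w j ≤ occ u i
      adjacent w≡ = begin
        occ w j
          ≡⟨ cong (λ v → occ v j) w≡ ⟩
        occ (suc u) j
          ≡⟨ count-hasVal-split u (suc u) 0 j ⟩
        O₁ j + F₁ j
          ≡⟨ cong (λ p → O₁ j + F₁ p) j≡ ⟩
        O₁ j + F₁ (i + t + m)
          ≡⟨ cong (O₁ j +_) (count-+-none (freeWith u (suc u)) 0 (i + t) m no-free-1+u-right) ⟩
        O₁ j + F₁ (i + t)
          ≤⟨ +-mono-≤ (overlapped-lattice u j i j≤N above-is-before-i) (free-lattice u 1≤u (i + t) i+t≤N) ⟩
        O₀ i + F₀ (i + t)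
          ≡⟨ cong (O₀ i +_) (count-+-none (freeWith u u) 0 i t no-free-u-left) ⟩
        O₀ i + F₀ i
          ≡⟨ count-hasVal-split u u 0 i ⟨
        occ u i ∎
        where
        open ≤-Reasoning
        open Split (split (suc u))
        O₀ F₀ O₁ F₁ : ℕ → ℕ
        O₀ = count (overlappedWith u u) 0
        F₀ = count (freeWith u u) 0
        O₁ = count (overlappedWith u (suc u)) 0
        F₁ = count (freeWith u (suc u)) 0
        no-free-1+u-right : ∀ k → InInterval (i + t) m k → freeWith u (suc u) k ≡ true → ⊥
        no-free-1+u-right k k∈ h = excluded (freeWith≡true⇒ h) (right k k∈)
          where
          excluded : val k ≡ suc u × overlapped u k ≡ false → i < k × k ≤ j × Right (suc u) k → ⊥
          excluded (vk , _)       (_ , _ , inj₂ (_ , vk<)) = <-irrefl vk vk<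
          excluded (vk , not-ovl) (i<k , k≤j , inj₁ (rk≡ , c≤ck)) =
            let (_ , _ , _ , _ , u≤vk' , vk'<u , _) = free-cell-above (middle-label i<k k≤j) rk≡ c≤ck vk not-ovl
            in <⇒≱ vk'<u u≤vk'
        no-free-u-left : ∀ k → InInterval i t k → freeWith u u k ≡ true → ⊥
        no-free-u-left k k∈ h = excluded (freeWith≡true⇒ h) (left k k∈)
          where
          excluded : val k ≡ u × overlapped u k ≡ false → i < k × k ≤ j × Left (suc u) k → ⊥
          excluded (vk , _)       (_ , _ , inj₂ (_ , 1+u≤vk)) = <-irrefl (sym vk) 1+u≤vk
          excluded (vk , not-ovl) (i<k , k≤j , inj₁ (rk≡ , ck<c)) =
            let (k' , k'∈ , ck' , vk<vk' , vk'≤w) = cell-below (middle-label i<k k≤j) rk≡ (<⇒≤ ck<c)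
                vk'≡1+u = ≤-antisym (subst (val k' ≤_) w≡ vk'≤w) (subst (_< val k') vk vk<vk')
            in false≢true (trans (sym not-ovl) (partner⇒overlapped u k k' k'∈ (ck' , inj₁ (vk , vk'≡1+u))))

      in-row-r-with-value-u : ℕ → Bool
      in-row-r-with-value-u k = (row k ≡ᵇ r) ∧ (val k ≡ᵇ u)

      -- Entries of row r weakly decrease along the labels down to u at i, so its u's before i form a final run.
      row-r-tail-upward : ∀ k k' → 0 < k → k ≤ k' → k' ≤ 0 + i →
        in-row-r-with-value-u k ≡ true → in-row-r-with-value-u k' ≡ true
      row-r-tail-upward k k' 0<k k≤k' k'≤i h = ∧-≡true (≡⇒≡ᵇ≡true rk'≡) (≡⇒≡ᵇ≡true vk'≡)
        where
        k'∈ : Label k'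
        k'∈ = <-≤-trans 0<k k≤k' , ≤-trans k'≤i i≤N
        k∈ : Label k
        k∈ = 0<k , ≤-trans k≤k' (proj₂ k'∈)
        rk≡ : row k ≡ r
        rk≡ = ≡ᵇ≡true⇒≡ (proj₁ (∧≡true⇒ h))
        rk'≡ : row k' ≡ r
        rk'≡ = ≤-antisym (label≤⇒row≤ k'∈ i∈ k'≤i) (subst (_≤ row k') rk≡ (label≤⇒row≤ k∈ k'∈ k≤k'))
        vk'≡ : val k' ≡ u
        vk'≡ = ≤-antisym (subst (val k' ≤_) (≡ᵇ≡true⇒≡ (proj₂ (∧≡true⇒ h)))
                                (val-row-antitone k∈ k'∈ (trans rk≡ (sym rk'≡)) k≤k'))
                         (val-row-antitone k'∈ i∈ rk'≡ k'≤i)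

      -- Each free 2 + u of row r + 2 right of c sits below a u of the final run of u's in row r.
      two-apart : w ≡ 2 + u → occ w j ≤ occ u i
      two-apart w≡ = from-tail (upward-closed-split in-row-r-with-value-u 0 i row-r-tail-upward)
        where
        open Split (split (2 + u))
        O₁ F₁ O₂ F₂ : ℕ → ℕ
        O₁ = count (overlappedWith (suc u) (suc u)) 0
        F₁ = count (freeWith (suc u) (suc u)) 0
        O₂ = count (overlappedWith (suc u) (2 + u)) 0
        F₂ = count (freeWith (suc u) (2 + u)) 0
        no-free-1+u-left : ∀ k → InInterval i t k → freeWith (suc u) (suc u) k ≡ true → ⊥
        no-free-1+u-left k k∈ h = excluded (freeWith≡true⇒ h) (left k k∈)
          where
          excluded : val k ≡ suc u × overlapped (suc u) k ≡ false → i < k × k ≤ j × Left (2 + u) k → ⊥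
          excluded (vk , _) (_ , _ , inj₂ (_ , 2+u≤vk)) = <-irrefl (sym vk) 2+u≤vk
          excluded (vk , _) (i<k , k≤j , inj₁ (rk≡ , _)) =
            <-irrefl vk (s≤s (val-row-antitone i∈ (middle-label i<k k≤j) (sym rk≡) (<⇒≤ i<k)))
        from-tail : (∃[ s₀ ] ∃[ s ] s₀ + s ≡ i × (∀ k → InInterval 0 s₀ k → in-row-r-with-value-u k ≡ false)
                                            × (∀ k → InInterval s₀ s k → in-row-r-with-value-u k ≡ true)) →
                    occ w j ≤ occ u i
        from-tail (s₀ , s , s₀+s≡i , before-tail , in-tail) = begin
          occ w j
            ≡⟨ cong (λ v → occ v j) w≡ ⟩
          occ (2 + u) j
            ≡⟨ count-hasVal-split (suc u) (2 + u) 0 j ⟩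
          O₂ j + F₂ j
            ≡⟨ cong (λ p → O₂ j + F₂ p) j≡ ⟩
          O₂ j + F₂ (i + t + m)
            ≡⟨ cong (O₂ j +_) (count-+ (freeWith (suc u) (2 + u)) 0 (i + t) m) ⟩
          O₂ j + (F₂ (i + t) + count (freeWith (suc u) (2 + u)) (i + t) m)
            ≤⟨ +-mono-≤ (overlapped-lattice (suc u) j i j≤N above-is-before-i)
                        (+-mono-≤ (free-lattice (suc u) (s≤s z≤n) (i + t) i+t≤N) free-right≤tail) ⟩
          O₁ i + (F₁ (i + t) + U)
            ≡⟨ cong (λ z → O₁ i + (z + U)) (count-+-none (freeWith (suc u) (suc u)) 0 i t no-free-1+u-left) ⟩
          O₁ i + (F₁ i + U)
            ≡⟨ +-assoc (O₁ i) (F₁ i) U ⟨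
          O₁ i + F₁ i + U
            ≡⟨ cong (_+ U) (count-hasVal-split (suc u) (suc u) 0 i) ⟨
          occ (suc u) i + U
            ≡⟨ cong (λ p → occ (suc u) p + U) (sym s₀+s≡i) ⟩
          occ (suc u) (s₀ + s) + U
            ≡⟨ cong (_+ U) (count-+-none (hasVal (suc u)) 0 s₀ s no-1+u-in-tail) ⟩
          occ (suc u) s₀ + U
            ≤⟨ +-monoˡ-≤ U (lattice u 1≤u s₀ (≤-trans (m≤m+n s₀ s) (subst (_≤ N) (sym s₀+s≡i) i≤N))) ⟩
          occ u s₀ + U
            ≡⟨ count-+ (hasVal u) 0 s₀ s ⟨
          occ u (s₀ + s)
            ≡⟨ cong (occ u) s₀+s≡i ⟩
          occ u i ∎
          where
          open ≤-Reasoning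
          U : ℕ
          U = count (hasVal u) s₀ s
          no-1+u-in-tail : ∀ k → InInterval s₀ s k → hasVal (suc u) k ≡ true → ⊥
          no-1+u-in-tail k k∈ h =
            1+n≢n (trans (sym (≡ᵇ≡true⇒≡ {val k} h)) (≡ᵇ≡true⇒≡ (proj₂ (∧≡true⇒ {row k ≡ᵇ r} (in-tail k k∈)))))
          R : ℕ → ℕ → Set
          R k k' = Label k × row k ≡ 2 + r × col k' ≡ col k
          to-tail : ∀ k → InInterval (i + t) m k → freeWith (suc u) (2 + u) k ≡ true →
                    ∃[ k' ] R k k' × InInterval s₀ s k' × hasVal u k' ≡ true
          to-tail k k∈ h = excluded (freeWith≡true⇒ h) (right k k∈)
            where
            after-s₀ : ∀ k' → Label k' → in-row-r-with-value-u k' ≡ true → s₀ < k'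
            after-s₀ k' k'∈ tail-k' with s₀ <? k'
            ... | yes s₀<k' = s₀<k'
            ... | no  s₀≮k' =
              ⊥-elim (false≢true (trans (sym (before-tail k' (proj₁ k'∈ , ≮⇒≥ s₀≮k'))) tail-k'))
            excluded : val k ≡ 2 + u × overlapped (suc u) k ≡ false → i < k × k ≤ j × Right (2 + u) k →
                       ∃[ k' ] R k k' × InInterval s₀ s k' × hasVal u k' ≡ true
            excluded (vk , _)       (_ , _ , inj₂ (_ , vk<)) = ⊥-elim (<-irrefl vk vk<)
            excluded (vk , not-ovl) (i<k , k≤j , inj₁ (rk≡ , c≤ck)) =
              let k∈L = middle-label i<k k≤j
                  (k' , k'∈ , rk' , ck' , u≤vk' , vk'<1+u , k'≤i) = free-cell-above k∈L rk≡ c≤ck vk not-ovl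
                  vk'≡u = ≤-antisym (≤-pred vk'<1+u) u≤vk'
                  tail-k' = ∧-≡true (≡⇒≡ᵇ≡true rk') (≡⇒≡ᵇ≡true vk'≡u)
              in k' , (k∈L , rk≡ , ck') , (after-s₀ k' k'∈ tail-k' , subst (k' ≤_) (sym s₀+s≡i) k'≤i) ,
                 ≡⇒≡ᵇ≡true vk'≡u
          free-right≤tail : count (freeWith (suc u) (2 + u)) (i + t) m ≤ U
          free-right≤tail = count-injection R (i + t) m s₀ s to-tail
            (λ (k₁∈ , r₁ , c₁) (k₂∈ , r₂ , c₂) → label-injective k₁∈ k₂∈ (trans r₁ (sym r₂)) (trans (sym c₁) c₂))

      vertical-occ : occ w j ≤ occ u i
      vertical-occ with w ≟ suc u | w ≟ 2 + u
      ... | yes w≡ | _      = adjacent w≡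
      ... | no _   | yes w≡ = two-apart w≡
      ... | no w≢1+u | no w≢2+u =
        far-apart (w ∸ 2) (∸-monoˡ-≤ 2 3+u≤w) (sym (m+[n∸m]≡n (≤-trans (s≤s (s≤s z≤n)) 3+u≤w)))
        where
        3+u≤w : 3 + u ≤ w
        3+u≤w = ≤∧≢⇒< (≤∧≢⇒< u<w (w≢1+u ∘ sym)) (w≢2+u ∘ sym)

    module Compatibility (pla : IsPartition la) (pmu : IsPartition mu) (pnu : IsPartition nu) (prh : IsPartition rh) where

      M : ℕ
      M = maxL (map (λ x → S (proj₁ x) (proj₂ x)) cellsD)

      labels-with-value : ℕ → List ℕ
      labels-with-value v = filterᵇ (hasVal v) (interval 0 N)

      rows-by-value : List (List ℕ)
      rows-by-value = map labels-with-value (interval 0 M)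

      phiInv≡rows-by-value : phiInv S ≡ rows-by-value
      phiInv≡rows-by-value = begin
        phiInv S
          ≡⟨ cong₂ (λ L I → map (λ v → map proj₁ (filterᵇ (has-value v) L)) I) labelled≡ (range1≡interval M) ⟩
        map (λ v → map proj₁ (filterᵇ (has-value v) (map with-cell (interval 0 N)))) (interval 0 M)
          ≡⟨ map-cong (λ v → trans (cong (map proj₁) (filterᵇ-map (has-value v) with-cell (interval 0 N)))
                                   (trans (sym (map-∘ (labels-with-value v))) (map-id (labels-with-value v))))
                      (interval 0 M) ⟩
        rows-by-value ∎
        where
        open ≡-Reasoning
        has-value : ℕ → ℕ × (ℕ × ℕ) → Bool
        has-value v x = S (proj₁ (proj₂ x)) (proj₂ (proj₂ x)) ≡ᵇ v
        with-cell : ℕ → ℕ × (ℕ × ℕ)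
        with-cell k = k , cellAt k
        labelled≡ : labelled ≡ map with-cell (interval 0 N)
        labelled≡ = trans (cong₂ zip (range1≡interval N) cellsD-by-label) (zip-map cellAt (interval 0 N))

      entry-decode : ∀ {a b e} → entry rows-by-value a b ≡ just e →
        InInterval 0 M a × Label e × val e ≡ a × occ a e ≡ b
      entry-decode {a} {b} {e} h with nth-rowOf-map-interval labels-with-value 0 M a b h
      ... | a∈ , h′ with nth-filterᵇ-interval (hasVal a) 0 N b e h′
      ...   | d , refl , d<N , has-a , occ≡b = a∈ , (s≤s z≤n , d<N) , ≡ᵇ≡true⇒≡ has-a , occ≡b

      val≤M : ∀ {k} → Label k → val k ≤ M
      val≤M {k} k∈ = ∈⇒≤maxL (subst (λ cs → val k ∈ map (λ x → S (proj₁ x) (proj₂ x)) cs) (sym cellsD-by-label)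
                                    (∈-map⁺ _ (∈-map⁺ cellAt (∈-interval⁺ k∈))))

      rows-shrink : ∀ a → 1 ≤ a → length (rowOf rows-by-value (suc a)) ≤ length (rowOf rows-by-value a)
      rows-shrink a 1≤a with suc a ≤? M
      ... | no  a≥M = subst (λ row → length row ≤ length (rowOf rows-by-value a))
                            (sym (rowOf-map-interval-beyond labels-with-value 0 M (suc a) (≰⇒> a≥M))) z≤n
      ... | yes a<M =
        subst₂ (λ row row' → length row ≤ length row')
               (sym (rowOf-map-interval labels-with-value 0 M (suc a) (s≤s z≤n , a<M)))
               (sym (rowOf-map-interval labels-with-value 0 M a (1≤a , <⇒≤ a<M)))
               (subst₂ _≤_ (sym (length-filterᵇ-interval (hasVal (suc a)) 0 N))
                           (sym (length-filterᵇ-interval (hasVal a) 0 N))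
                       (lattice a 1≤a N ≤-refl))

      rows-increase : ∀ a b x y → entry rows-by-value a b ≡ just x → entry rows-by-value a (suc b) ≡ just y →
        x < y
      rows-increase a b x y hx hy with entry-decode hx | entry-decode hy
      ... | _ , _ , _ , occ-x | _ , _ , _ , occ-y with x <? y
      ...   | yes x<y = x<y
      ...   | no  x≮y = ⊥-elim (1+n≰n (subst₂ _≤_ occ-y occ-x (count-monoʳ (hasVal a) 0 (≮⇒≥ x≮y))))

      cols-increase : ∀ a b x y → entry rows-by-value a b ≡ just x → entry rows-by-value (suc a) b ≡ just y →
        x < y
      cols-increase a b x y hx hy with entry-decode hx | entry-decode hy
      ... | (1≤a , _) , _ , val-x , occ-x | _ , y∈ , val-y , occ-y with <-cmp x y
      ...   | tri< x<y _ _ = x<y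
      ...   | tri≈ _ refl _ = ⊥-elim (1+n≢n (trans (sym val-y) val-x))
      ...   | tri> _ _ (s≤s y≤x′) = ⊥-elim (1+n≰n (begin
        suc b                          ≡⟨ cong suc occ-y ⟨
        suc (occ (suc a) y)            ≤⟨ s≤s (lattice a 1≤a y (proj₂ y∈)) ⟩
        suc (occ a y)                  ≤⟨ s≤s (count-monoʳ (hasVal a) 0 y≤x′) ⟩
        suc (occ a (pred x))           ≡⟨ +-comm 1 _ ⟩
        occ a (pred x) + 1             ≡⟨ cong (λ n → occ a (pred x) + fromBool n) (≡⇒≡ᵇ≡true val-x) ⟨
        occ a (pred x) + fromBool (hasVal a x) ≡⟨ count-snoc (hasVal a) 0 (pred x) ⟨
        occ a x                        ≡⟨ occ-x ⟩
        b                              ∎))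
        where open ≤-Reasoning

      concat-↭ : concat rows-by-value ↭ range1 N
      concat-↭ = subst (concat rows-by-value ↭_) (sym (range1≡interval N))
        (Buckets.buckets-↭ val (interval 0 N) 0 M
          (All.tabulate (λ k∈ → let k∈L = ∈-interval⁻ k∈ in val-pos k∈L , val≤M k∈L)))

      consecutive-labels : ∀ i r c c' → cellOf i ≡ just (r , c) → cellOf (suc i) ≡ just (r , c') →
        ∀ a b a' b' → At rows-by-value i a b → At rows-by-value (suc i) a' b' → a' ≤ a × b < b'
      consecutive-labels i r c c' cell-i cell-i+1 a b a' b' at-i at-i+1
        with cellOf⇒label cell-i | cellOf⇒label cell-i+1 | entry-decode at-i | entry-decode at-i+1
      ... | i∈ , ri , _ | i+1∈ , ri+1 , _ | _ , _ , val-i , occ-i | (1≤a' , _) , _ , val-i+1 , occ-i+1 =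
        a'≤a , (begin-strict
          b                           ≡⟨ occ-i ⟨
          occ a i                     ≤⟨ lattice-antitone 1≤a' a'≤a i (proj₂ i∈) ⟩
          occ a' i                    <⟨ n<1+n _ ⟩
          suc (occ a' i)              ≡⟨ +-comm 1 _ ⟩
          occ a' i + 1                ≡⟨ cong (λ n → occ a' i + fromBool n) (≡⇒≡ᵇ≡true val-i+1) ⟨
          occ a' i + fromBool (hasVal a' (suc i)) ≡⟨ count-snoc (hasVal a') 0 i ⟨
          occ a' (suc i)              ≡⟨ occ-i+1 ⟩
          b'                          ∎)
        where
        open ≤-Reasoning
        a'≤a : a' ≤ a
        a'≤a = subst₂ _≤_ val-i+1 val-i (val-row-antitone i∈ i+1∈ (trans ri (sym ri+1)) (n≤1+n i))

      vertical-labels : ∀ i j r c → cellOf i ≡ just (r , c) → cellOf j ≡ just (2 + r , c) →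
        ∀ a b a' b' → At rows-by-value i a b → At rows-by-value j a' b' → a < a' × b' ≤ b
      vertical-labels i j r c cell-i cell-j a b a' b' at-i at-j
        with cellOf⇒label cell-i | cellOf⇒label cell-j | entry-decode at-i | entry-decode at-j
      ... | i∈ , ri , ci | j∈ , rj , cj | _ , _ , val-i , occ-i | _ , _ , val-j , occ-j =
        subst₂ _<_ val-i val-j u<w ,
        subst₂ _≤_ occ-j occ-i (subst₂ (λ v v' → occ v j ≤ occ v' i) val-j val-i vertical-occ)
        where
        open VerticalPair pla pmu pnu prh i∈ j∈ (trans cj (sym ci)) (trans rj (cong (2 +_) (sym ri)))

      is-D-compatible : IsDCompatible (phiInv S)
      is-D-compatible = subst IsDCompatible (sym phiInv≡rows-by-value)
        ((rows-shrink , rows-increase , cols-increase , concat-↭) , consecutive-labels , vertical-labels)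

lemma2p17 : (la mu nu rh : List ℕ)
    → IsPartition la → IsPartition mu → IsPartition nu → IsPartition rh
    → mu ⊆ₚ la → rh ⊆ₚ nu
    → (S : ℕ → ℕ → ℕ)
    → Shuffle.IsShuffleTableau la mu nu rh S
    → Shuffle.IsYamanouchi la mu nu rh S
    → Shuffle.IsDCompatible la mu nu rh (Shuffle.phiInv la mu nu rh S)
lemma2p17 la mu nu rh pla pmu pnu prh _ _ S ST Y =
  Tableau.Compatibility.is-D-compatible la mu nu rh S ST Y pla pmu pnu prh
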